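{- Let $u\in[2]^n$ be a word of length $n$ over $\{1,2\}$ with $m_1(u)=m_2(u)\ge1$. Then for a word $w$ over the positive integers, $w\in C(u)$ if and only if both of the following hold: (a) $\min(c_1(w),c_2(w))\ge c_1(u)$, or $c_1(w)=c_2(w)<c_1(u)$; (b) $\max R_i(w)\le 2$ for $i\le 2$.
   Context: Juxtaposition denotes concatenation of words. $P(w)$ is the insertion tableau of $w$ under the Robinson–Schensted–Knuth (row-insertion) correspondence, and $C(u)=\{w : P(uw)=P(wu)\}$. $R_i(w)$ denotes the $i$th row of $P(w)$ (empty if $P(w)$ has fewer than $i$ rows; the condition $\max R_i(w)\le2$ holds vacuously for an empty row). $m_a(u)$ is the number of occurrences of the letter $a$ in $u$. For a positive integer $a$, $c_a(w)$ is the number of singleton $a$-columns of $P(w)$, i.e. columns of $P(w)$ of length exactly one whose sole entry is $a$. -}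

module Defs where

open import Data.Nat using (ℕ; zero; suc; _<_; _≤_; _≟_; _<?_)
open import Data.List using (List; []; _∷_; _++_; length; filter; foldl; upTo; concatMap)
open import Data.List.Properties using (≡-dec)
open import Data.Maybe using (Maybe; just; nothing)
open import Data.Product using (_×_; _,_)
open import Relation.Nullary using (yes; no)

-- A word is a list of letters; a tableau is a list of rows, top row first.
Word : Set
Word = List ℕ

Tableau : Set
Tableau = List (List ℕ)

insertRow : ℕ → List ℕ → Maybe ℕ × List ℕ
insertRow x [] = nothing , x ∷ []
insertRow x (y ∷ ys) with x <? y
... | yes _ = just y , x ∷ ys
... | no _ with insertRow x ys
...   | b , r = b , y ∷ r

insertT : ℕ → Tableau → Tableau
insertT x [] = (x ∷ []) ∷ []
insertT x (r ∷ rs) with insertRow x r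
... | nothing , r' = r' ∷ rs
... | just y , r' = r' ∷ insertT y rs

P : Word → Tableau
P w = foldl (λ T x → insertT x T) [] w

_∈C_ : Word → Word → Set
w ∈C u = P (u ++ w) ≡ P (w ++ u)
  where open import Relation.Binary.PropositionalEquality using (_≡_)

-- i-th row of a tableau (1-indexed); empty if there are fewer rows.
rowT : ℕ → Tableau → List ℕ
rowT zero _ = []
rowT (suc i) [] = []
rowT (suc zero) (r ∷ rs) = r
rowT (suc (suc i)) (r ∷ rs) = rowT (suc i) rs

R : ℕ → Word → List ℕ
R i w = rowT i (P w)

m : ℕ → Word → ℕ
m a u = length (filter (a ≟_) u)

-- j-th entry (0-indexed) of a list, as a singleton list or empty
entryAt : ℕ → List ℕ → List ℕ
entryAt _ [] = []
entryAt zero (x ∷ _) = x ∷ []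
entryAt (suc j) (_ ∷ xs) = entryAt j xs

column : ℕ → Tableau → List ℕ
column j T = concatMap (entryAt j) T

numCols : Tableau → ℕ
numCols [] = 0
numCols (r ∷ _) = length r

-- c_a(w): number of columns of P(w) equal to the one-entry column [a]
c : ℕ → Word → ℕ
c a w = length (filter (λ j → ≡-dec _≟_ (column j (P w)) (a ∷ [])) (upTo (numCols (P w))))

{-# OPTIONS --safe #-}
-- Write T = P(w).  As u only has letters 1 and 2, P(u w) arises from T by
-- column-inserting the letters of u, which only touches the first two rows, and
-- P(w u) by row-inserting them.  Column insertion never lowers the number of
-- letters larger than 2 in row 1 and keeps their number in rows 1 and 2 together.
-- Row insertion of u (which contains a 2) lowers the first count if it is
-- positive, and when row 2 holds a large letter it either lowers the second or
-- every 1 of u meets no 2 in row 1, which the profiles below rule out: hence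
-- condition (b).  A tableau whose first two rows hold only 1s and 2s is determined
-- by its lower rows and its profile (the numbers of 1s and 2s in row 1 and of 2s
-- in row 2), which both insertions change by explicit rules.  Replacing u by the
-- reading word 2^j 1^k 2^d of P(u), where d = c₁(u) counts the 1s of u that meet
-- no 2 in row 1, the two profiles agree exactly when d ∸ c₁(w) = d ∸ c₂(w), which
-- is condition (a).
module Submission where

open import Defs
open import Data.Nat
open import Data.Nat.Properties
open import Data.List using (List; []; _∷_; _++_; length; replicate; foldl; foldr; filter; upTo; concatMap)
open import Data.List.Properties using (foldl-++; foldr-++; ++-identityʳ; length-replicate; length-++; upTo-∷ʳ; ≡-dec; filter-accept; filter-reject; ++-conicalˡ; ++-conicalʳ)
open import Data.List.Relation.Unary.All using (All; []; _∷_)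
import Data.List.Relation.Unary.All as All
open import Data.List.Relation.Unary.All.Properties using (++⁺; replicate⁺)
open import Data.Maybe using (Maybe; just; nothing)
open import Data.Product using (_×_; _,_; proj₁; proj₂; ∃; ∃-syntax)
open import Data.Sum using (_⊎_; inj₁; inj₂) renaming (map to map⊎)
open import Data.Empty using (⊥; ⊥-elim)
open import Data.Unit using (⊤; tt)
open import Data.Bool using (true; false)
open import Function.Bundles using (_⇔_; mk⇔; Equivalence)
open import Relation.Nullary using (yes; no; ¬_; Dec; does)
open import Relation.Nullary.Decidable.Core using (_×-dec_)
open import Relation.Unary using (Pred; Decidable)
open import Relation.Binary.PropositionalEquality
open import Algebra.Properties.CommutativeSemigroup +-commutativeSemigroup using (xy∙z≈zy∙x; xy∙z≈yz∙x; xy∙z≈xz∙y; x∙yz≈xz∙y)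
open import Data.Nat.Tactic.RingSolver using (solve-∀)


-- Row insertion into one row, and column insertion into two rows

insertRow-< : ∀ {y a} A → y < a → insertRow y (a ∷ A) ≡ (just a , y ∷ A)
insertRow-< {y} {a} A y<a with y <? a
... | yes _ = refl
... | no y≮a = ⊥-elim (y≮a y<a)

insertRow-≮ : ∀ {y a} A → ¬ y < a →
  insertRow y (a ∷ A) ≡ (proj₁ (insertRow y A) , a ∷ proj₂ (insertRow y A))
insertRow-≮ {y} {a} A y≮a with y <? a
... | yes y<a = ⊥-elim (y≮a y<a)
... | no _ = refl

insertRowᵐ : Maybe ℕ → List ℕ → Maybe ℕ × List ℕ
insertRowᵐ nothing A = (nothing , A)
insertRowᵐ (just v) A = insertRow v A

HeadAtLeast : ℕ → List ℕ → Set
HeadAtLeast z [] = ⊤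
HeadAtLeast z (b ∷ _) = z ≤ b

Sorted : List ℕ → Set
Sorted [] = ⊤
Sorted (x ∷ A) = HeadAtLeast x A × Sorted A

ColStrict : List ℕ → List ℕ → Set
ColStrict A [] = ⊤
ColStrict [] (_ ∷ _) = ⊥
ColStrict (a ∷ A) (b ∷ B) = a < b × ColStrict A B

-- Column insertion of z into the first two rows (A, B) of a tableau, faithful
-- when every entry of B is at least z (as for z ≤ 2): z either slides in front
-- of A, or goes under a smaller top entry and pushes the entry below it into
-- the next column.
colInsert : ℕ → List ℕ → List ℕ → List ℕ × List ℕ
colInsert z [] B = (z ∷ [] , B)
colInsert z (a ∷ A) [] with a <? z
... | yes _ = (a ∷ A , z ∷ [])
... | no _ = (z ∷ a ∷ A , [])
colInsert z (a ∷ A) (b ∷ B) with a <? z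
... | yes _ = (a ∷ proj₁ (colInsert b A B) , z ∷ proj₂ (colInsert b A B))
... | no _ = (z ∷ a ∷ A , b ∷ B)

colInsert-[]-< : ∀ {z a} A → a < z → colInsert z (a ∷ A) [] ≡ (a ∷ A , z ∷ [])
colInsert-[]-< {z} {a} A a<z with a <? z
... | yes _ = refl
... | no a≮z = ⊥-elim (a≮z a<z)

colInsert-∷-< : ∀ {z a b} A B → a < z →
  colInsert z (a ∷ A) (b ∷ B) ≡ (a ∷ proj₁ (colInsert b A B) , z ∷ proj₂ (colInsert b A B))
colInsert-∷-< {z} {a} A B a<z with a <? z
... | yes _ = refl
... | no a≮z = ⊥-elim (a≮z a<z)

colInsert-≮ : ∀ {z a} A B → ¬ a < z → colInsert z (a ∷ A) B ≡ (z ∷ a ∷ A , B)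
colInsert-≮ {z} {a} A [] a≮z with a <? z
... | yes a<z = ⊥-elim (a≮z a<z)
... | no _ = refl
colInsert-≮ {z} {a} A (b ∷ B) a≮z with a <? z
... | yes a<z = ⊥-elim (a≮z a<z)
... | no _ = refl

colInsert-headAtLeast : ∀ {z} A B → HeadAtLeast z A → colInsert z A B ≡ (z ∷ A , B)
colInsert-headAtLeast [] B h = refl
colInsert-headAtLeast (a ∷ A) B z≤a = colInsert-≮ A B (≤⇒≯ z≤a)

insertRow-bump-> : ∀ y A {v X} → insertRow y A ≡ (just v , X) → y < v
insertRow-bump-> y [] ()
insertRow-bump-> y (a ∷ A) eq with y <? a
insertRow-bump-> y (a ∷ A) refl | yes y<a = y<a
... | no _ with insertRow y A in e
insertRow-bump-> y (a ∷ A) refl | no _ | just v , X = insertRow-bump-> y A e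

insertRow-bump-head≤ : ∀ y A {v X} → insertRow y A ≡ (just v , X) →
  ∃[ x ] ∃[ X' ] (X ≡ x ∷ X' × x ≤ y)
insertRow-bump-head≤ y [] ()
insertRow-bump-head≤ y (a ∷ A) eq with y <? a
insertRow-bump-head≤ y (a ∷ A) refl | yes _ = y , A , refl , ≤-refl
... | no y≮a with insertRow y A
insertRow-bump-head≤ y (a ∷ A) refl | no y≮a | just v , X = a , X , refl , ≮⇒≥ y≮a

headAtLeast-insertRow : ∀ {z} y A → HeadAtLeast z A → z ≤ y → HeadAtLeast z (proj₂ (insertRow y A))
headAtLeast-insertRow y [] h z≤y = z≤y
headAtLeast-insertRow y (a ∷ A) h z≤y with y <? a
... | yes _ = z≤y
... | no _ = h


-- Row insertion commutes with column insertion of 1 or 2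

-- A frame is the part of the first two rows to the right of a column whose
-- row-2 entry is g.  A letter v < g bumped out of the row-1 part belongs in row 2
-- to the left of the frame and is reported as `left v`; `down` reports the letter
-- (if any) that leaves row 2 of the frame.  rowAfterCol and colAfterRow finish
-- the two orders of inserting into a frame, reattach restores a peeled column.
data Exit : Set where
  down : Maybe ℕ → Exit
  left : ℕ → Exit

Frame : Set
Frame = Exit × List ℕ × List ℕ

rowAfterCol : ℕ → Maybe ℕ × List ℕ → List ℕ → Frame
rowAfterCol g (nothing , A) B = (down nothing , A , B)
rowAfterCol g (just v , A) B with v <? g
... | yes _ = (left v , A , B)
... | no _ = (down (proj₁ (insertRow v B)) , A , proj₂ (insertRow v B))

colAfterRow : ℕ → ℕ → List ℕ → Maybe ℕ × List ℕ → Frame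
colAfterRow g z B (nothing , A) = (down nothing , colInsert z A B)
colAfterRow g z B (just v , A) with v <? g
... | yes _ = (left v , colInsert z A B)
... | no _ with v <? z
...   | yes _ = (down (just z) , colInsert v A B)
...   | no _ = (down (proj₁ (insertRow v B)) , colInsert z A (proj₂ (insertRow v B)))

reattach : ℕ → ℕ → ℕ → Frame → Frame
reattach g a z (down x , A , B) = (down x , a ∷ A , z ∷ B)
reattach g a z (left v , A , B) with v <? g
... | yes _ = (left v , a ∷ A , z ∷ B)
... | no _ = (down (just z) , a ∷ A , v ∷ B)

rowAfterCol-left : ∀ {g v} A B → v < g → rowAfterCol g (just v , A) B ≡ (left v , A , B)
rowAfterCol-left {g} {v} A B v<g with v <? g
... | yes _ = refl
... | no v≮g = ⊥-elim (v≮g v<g)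

rowAfterCol-down : ∀ {g v} A B → ¬ v < g →
  rowAfterCol g (just v , A) B ≡ (down (proj₁ (insertRow v B)) , A , proj₂ (insertRow v B))
rowAfterCol-down {g} {v} A B v≮g with v <? g
... | yes v<g = ⊥-elim (v≮g v<g)
... | no _ = refl

colAfterRow-left : ∀ {g z v} B A → v < g → colAfterRow g z B (just v , A) ≡ (left v , colInsert z A B)
colAfterRow-left {g} {z} {v} B A v<g with v <? g
... | yes _ = refl
... | no v≮g = ⊥-elim (v≮g v<g)

colAfterRow-under : ∀ {g z v} B A → ¬ v < g → v < z →
  colAfterRow g z B (just v , A) ≡ (down (just z) , colInsert v A B)
colAfterRow-under {g} {z} {v} B A v≮g v<z with v <? g
... | yes v<g = ⊥-elim (v≮g v<g)
... | no _ with v <? z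
...   | yes _ = refl
...   | no v≮z = ⊥-elim (v≮z v<z)

colAfterRow-down : ∀ {g z v} B A → ¬ v < g → ¬ v < z →
  colAfterRow g z B (just v , A) ≡ (down (proj₁ (insertRow v B)) , colInsert z A (proj₂ (insertRow v B)))
colAfterRow-down {g} {z} {v} B A v≮g v≮z with v <? g
... | yes v<g = ⊥-elim (v≮g v<g)
... | no _ with v <? z
...   | yes v<z = ⊥-elim (v≮z v<z)
...   | no _ = refl

reattach-left : ∀ {g a z v} A B → v < g → reattach g a z (left v , A , B) ≡ (left v , a ∷ A , z ∷ B)
reattach-left {g} {a} {z} {v} A B v<g with v <? g
... | yes _ = refl
... | no v≮g = ⊥-elim (v≮g v<g)

reattach-down : ∀ {g a z v} A B → ¬ v < g → reattach g a z (left v , A , B) ≡ (down (just z) , a ∷ A , v ∷ B)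
reattach-down {g} {a} {z} {v} A B v≮g with v <? g
... | yes v<g = ⊥-elim (v≮g v<g)
... | no _ = refl

rowAfterCol-reattach : ∀ g a z (r : Maybe ℕ × List ℕ) B → g ≤ z →
  rowAfterCol g (proj₁ r , a ∷ proj₂ r) (z ∷ B) ≡ reattach g a z (rowAfterCol z r B)
rowAfterCol-reattach g a z (nothing , A) B g≤z = refl
rowAfterCol-reattach g a z (just v , A) B g≤z with v <? g
... | yes v<g rewrite rowAfterCol-left {z} A B (<-≤-trans v<g g≤z) | reattach-left {g} {a} {z} A B v<g = refl
... | no v≮g with v <? z
...   | yes _ rewrite reattach-down {g} {a} {z} A B v≮g = refl
...   | no _ = refl

colAfterRow-reattach : ∀ g a z b B (r : Maybe ℕ × List ℕ) → g ≤ z → a < z →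
  (∀ {v} → proj₁ r ≡ just v → a < v) →
  colAfterRow g z (b ∷ B) (proj₁ r , a ∷ proj₂ r) ≡ reattach g a z (colAfterRow z b B r)
colAfterRow-reattach g a z b B (nothing , A) g≤z a<z _ rewrite colInsert-∷-< {z} {a} {b} A B a<z = refl
colAfterRow-reattach g a z b B (just v , A) g≤z a<z a<bump with v <? g
... | yes v<g rewrite colAfterRow-left {z} {b} B A (<-≤-trans v<g g≤z) | colInsert-∷-< {z} {a} {b} A B a<z
                    | reattach-left {g} {a} {z} (proj₁ (colInsert b A B)) (proj₂ (colInsert b A B)) v<g = refl
... | no v≮g with v <? z
...   | yes _ rewrite colInsert-∷-< {v} {a} {b} A B (a<bump refl)
                    | reattach-down {g} {a} {z} (proj₁ (colInsert b A B)) (proj₂ (colInsert b A B)) v≮g = refl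
...   | no _ with v <? b
...     | yes _ rewrite colInsert-∷-< {z} {a} {v} A B a<z = refl
...     | no _ rewrite colInsert-∷-< {z} {a} {b} A (proj₂ (insertRow v B)) a<z = refl

split< : ∀ {ℓ} {X : Set ℓ} y z → (y < z → X) → (¬ y < z → X) → X
split< y z f g with y <? z
... | yes y<z = f y<z
... | no y≮z = g y≮z

insertRow-colInsert-comm-[] : ∀ g z y → g ≤ z →
  rowAfterCol g (insertRow y (z ∷ [])) [] ≡ colAfterRow g z [] (insertRow y [])
insertRow-colInsert-comm-[] g z y g≤z = split< y z
  (λ y<z → begin
     rowAfterCol g (insertRow y (z ∷ [])) []
       ≡⟨ cong (λ r → rowAfterCol g r []) (insertRow-< {y} {z} [] y<z) ⟩
     rowAfterCol g (just z , y ∷ []) []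
       ≡⟨ rowAfterCol-down {g} {z} (y ∷ []) [] (≤⇒≯ g≤z) ⟩
     (down nothing , y ∷ [] , z ∷ [])
       ≡⟨ cong (down nothing ,_) (sym (colInsert-[]-< {z} {y} [] y<z)) ⟩
     (down nothing , colInsert z (y ∷ []) []) ∎)
  (λ y≮z → begin
     rowAfterCol g (insertRow y (z ∷ [])) []
       ≡⟨ cong (λ r → rowAfterCol g r []) (insertRow-≮ {y} {z} [] y≮z) ⟩
     (down nothing , z ∷ y ∷ [] , [])
       ≡⟨ cong (down nothing ,_) (sym (colInsert-≮ {z} {y} [] [] y≮z)) ⟩
     (down nothing , colInsert z (y ∷ []) []) ∎)
  where open ≡-Reasoning

insertRow-colInsert-comm-≤ : ∀ g z a A B y → HeadAtLeast a A → ColStrict (a ∷ A) B → g ≤ z → z ≤ a →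
  rowAfterCol g (insertRow y (z ∷ a ∷ A)) B ≡ colAfterRow g z B (insertRow y (a ∷ A))
insertRow-colInsert-comm-≤ g z a A B y a≤A strict g≤z z≤a = split< y z y<z y≮z
  where
  open ≡-Reasoning
  y<z : y < z → rowAfterCol g (insertRow y (z ∷ a ∷ A)) B ≡ colAfterRow g z B (insertRow y (a ∷ A))
  y<z y<z rewrite insertRow-< (a ∷ A) y<z | insertRow-< A (<-≤-trans y<z z≤a)
                | rowAfterCol-down {g} {z} (y ∷ a ∷ A) B (≤⇒≯ g≤z)
                | colAfterRow-down {g} {z} {a} B (y ∷ A) (≤⇒≯ (≤-trans g≤z z≤a)) (≤⇒≯ z≤a) = settle B strict
    where
    z∷A : ∀ B → colInsert z (y ∷ A) (a ∷ B) ≡ (y ∷ a ∷ A , z ∷ B)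
    z∷A B = trans (colInsert-∷-< {z} {y} {a} A B y<z)
                  (cong (λ r → (y ∷ proj₁ r , z ∷ proj₂ r)) (colInsert-headAtLeast {a} A B a≤A))
    settle : ∀ B → ColStrict (a ∷ A) B →
      (down (proj₁ (insertRow z B)) , y ∷ a ∷ A , proj₂ (insertRow z B))
      ≡ (down (proj₁ (insertRow a B)) , colInsert z (y ∷ A) (proj₂ (insertRow a B)))
    settle [] _ = cong (down nothing ,_) (sym (z∷A []))
    settle (b ∷ B) (a<b , _) = begin
      (down (proj₁ (insertRow z (b ∷ B))) , y ∷ a ∷ A , proj₂ (insertRow z (b ∷ B)))
        ≡⟨ cong (λ r → (down (proj₁ r) , y ∷ a ∷ A , proj₂ r)) (insertRow-< {z} {b} B (≤-<-trans z≤a a<b)) ⟩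
      (down (just b) , y ∷ a ∷ A , z ∷ B)
        ≡⟨ cong (down (just b) ,_) (sym (z∷A B)) ⟩
      (down (just b) , colInsert z (y ∷ A) (a ∷ B))
        ≡⟨ cong (λ r → (down (proj₁ r) , colInsert z (y ∷ A) (proj₂ r))) (sym (insertRow-< {a} {b} B a<b)) ⟩
      (down (proj₁ (insertRow a (b ∷ B))) , colInsert z (y ∷ A) (proj₂ (insertRow a (b ∷ B)))) ∎
  y≮z : ¬ y < z → rowAfterCol g (insertRow y (z ∷ a ∷ A)) B ≡ colAfterRow g z B (insertRow y (a ∷ A))
  y≮z y≮z rewrite insertRow-≮ {y} {z} (a ∷ A) y≮z =
    settle (insertRow y (a ∷ A)) (headAtLeast-insertRow y (a ∷ A) z≤a (≮⇒≥ y≮z)) (insertRow-bump-> y (a ∷ A))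
    where
    settle : ∀ r → HeadAtLeast z (proj₂ r) → (∀ {v X} → r ≡ (just v , X) → y < v) →
      rowAfterCol g (proj₁ r , z ∷ proj₂ r) B ≡ colAfterRow g z B r
    settle (nothing , X) z≤X _ rewrite colInsert-headAtLeast {z} X B z≤X = refl
    settle (just v , X) z≤X y<v with ≤-trans (≮⇒≥ y≮z) (<⇒≤ (y<v refl))
    ... | z≤v rewrite rowAfterCol-down {g} {v} (z ∷ X) B (≤⇒≯ (≤-trans g≤z z≤v))
                    | colAfterRow-down {g} {z} {v} B X (≤⇒≯ (≤-trans g≤z z≤v)) (≤⇒≯ z≤v)
                    | colInsert-headAtLeast {z} X (proj₂ (insertRow v B)) z≤X = refl

-- When y does not displace a, the first column (a over z) stays put.
insertRow-colInsert-comm-<-[]-≮ : ∀ g z a y (r : Maybe ℕ × List ℕ) → a < z → ¬ y < a →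
  (∀ {v X} → r ≡ (just v , X) → y < v) → (∀ {v X} → r ≡ (just v , X) → ∃[ x ] ∃[ X' ] (X ≡ x ∷ X' × x ≤ y)) →
  rowAfterCol g (proj₁ r , a ∷ proj₂ r) (z ∷ []) ≡ colAfterRow g z [] (proj₁ r , a ∷ proj₂ r)
insertRow-colInsert-comm-<-[]-≮ g z a y (nothing , X) a<z y≮a _ _ rewrite colInsert-[]-< {z} {a} X a<z = refl
insertRow-colInsert-comm-<-[]-≮ g z a y (just v , X) a<z y≮a y<v head≤y = split< v g
  (λ v<g → begin
    rowAfterCol g (just v , a ∷ X) (z ∷ []) ≡⟨ rowAfterCol-left (a ∷ X) (z ∷ []) v<g ⟩
    (left v , a ∷ X , z ∷ []) ≡⟨ cong (left v ,_) (sym (colInsert-[]-< {z} {a} X a<z)) ⟩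
    (left v , colInsert z (a ∷ X) []) ≡⟨ sym (colAfterRow-left {g} {z} [] (a ∷ X) v<g) ⟩
    colAfterRow g z [] (just v , a ∷ X) ∎)
  (λ v≮g → split< v z
    (λ v<z → begin
      rowAfterCol g (just v , a ∷ X) (z ∷ []) ≡⟨ rowAfterCol-down (a ∷ X) (z ∷ []) v≮g ⟩
      (down (proj₁ (insertRow v (z ∷ []))) , a ∷ X , proj₂ (insertRow v (z ∷ [])))
        ≡⟨ cong (λ r → (down (proj₁ r) , a ∷ X , proj₂ r)) (insertRow-< {v} {z} [] v<z) ⟩
      (down (just z) , a ∷ X , v ∷ []) ≡⟨ cong (down (just z) ,_) (sym (colInsert-[]-< {v} {a} X a<v)) ⟩
      (down (just z) , colInsert v (a ∷ X) []) ≡⟨ sym (colAfterRow-under {g} {z} [] (a ∷ X) v≮g v<z) ⟩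
      colAfterRow g z [] (just v , a ∷ X) ∎)
    (λ v≮z → begin
      rowAfterCol g (just v , a ∷ X) (z ∷ []) ≡⟨ rowAfterCol-down (a ∷ X) (z ∷ []) v≮g ⟩
      (down (proj₁ (insertRow v (z ∷ []))) , a ∷ X , proj₂ (insertRow v (z ∷ [])))
        ≡⟨ cong (λ r → (down (proj₁ r) , a ∷ X , proj₂ r)) (insertRow-≮ {v} {z} [] v≮z) ⟩
      (down nothing , a ∷ X , z ∷ v ∷ []) ≡⟨ cong (down nothing ,_) (sym z∷v) ⟩
      (down nothing , colInsert z (a ∷ X) (v ∷ [])) ≡⟨ sym (colAfterRow-down {g} {z} [] (a ∷ X) v≮g v≮z) ⟩
      colAfterRow g z [] (just v , a ∷ X) ∎))
  where
  open ≡-Reasoning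
  a<v : a < v
  a<v = ≤-<-trans (≮⇒≥ y≮a) (y<v refl)
  z∷v : colInsert z (a ∷ X) (v ∷ []) ≡ (a ∷ X , z ∷ v ∷ [])
  z∷v with head≤y refl
  ... | x , X' , refl , x≤y rewrite colInsert-∷-< {z} {a} {v} (x ∷ X') [] a<z
                                  | colInsert-[]-< {v} {x} X' (≤-<-trans x≤y (y<v refl)) = refl

insertRow-colInsert-comm-<-[] : ∀ g z a A y → a < z →
  rowAfterCol g (insertRow y (a ∷ A)) (z ∷ []) ≡ colAfterRow g z [] (insertRow y (a ∷ A))
insertRow-colInsert-comm-<-[] g z a A y a<z = split< y a y<a y≮a
  where
  open ≡-Reasoning
  y<a : y < a → rowAfterCol g (insertRow y (a ∷ A)) (z ∷ []) ≡ colAfterRow g z [] (insertRow y (a ∷ A))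
  y<a y<a rewrite insertRow-< A y<a = split< a g
    (λ a<g → begin
      rowAfterCol g (just a , y ∷ A) (z ∷ []) ≡⟨ rowAfterCol-left (y ∷ A) (z ∷ []) a<g ⟩
      (left a , y ∷ A , z ∷ []) ≡⟨ cong (left a ,_) (sym (colInsert-[]-< {z} {y} A (<-trans y<a a<z))) ⟩
      (left a , colInsert z (y ∷ A) []) ≡⟨ sym (colAfterRow-left {g} {z} [] (y ∷ A) a<g) ⟩
      colAfterRow g z [] (just a , y ∷ A) ∎)
    (λ a≮g → begin
      rowAfterCol g (just a , y ∷ A) (z ∷ []) ≡⟨ rowAfterCol-down (y ∷ A) (z ∷ []) a≮g ⟩
      (down (proj₁ (insertRow a (z ∷ []))) , y ∷ A , proj₂ (insertRow a (z ∷ [])))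
        ≡⟨ cong (λ r → (down (proj₁ r) , y ∷ A , proj₂ r)) (insertRow-< {a} {z} [] a<z) ⟩
      (down (just z) , y ∷ A , a ∷ []) ≡⟨ cong (down (just z) ,_) (sym (colInsert-[]-< {a} {y} A y<a)) ⟩
      (down (just z) , colInsert a (y ∷ A) []) ≡⟨ sym (colAfterRow-under {g} {z} [] (y ∷ A) a≮g a<z) ⟩
      colAfterRow g z [] (just a , y ∷ A) ∎)
  y≮a : ¬ y < a → rowAfterCol g (insertRow y (a ∷ A)) (z ∷ []) ≡ colAfterRow g z [] (insertRow y (a ∷ A))
  y≮a y≮a rewrite insertRow-≮ {y} {a} A y≮a =
    insertRow-colInsert-comm-<-[]-≮ g z a y (insertRow y A) a<z y≮a (insertRow-bump-> y A) (insertRow-bump-head≤ y A)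

insertRow-colInsert-comm : ∀ g z A B y → Sorted A → Sorted B → ColStrict A B → g ≤ z → HeadAtLeast z B →
  rowAfterCol g (insertRow y (proj₁ (colInsert z A B))) (proj₂ (colInsert z A B))
  ≡ colAfterRow g z B (insertRow y A)
insertRow-colInsert-comm g z [] [] y _ _ _ g≤z _ = insertRow-colInsert-comm-[] g z y g≤z
insertRow-colInsert-comm g z (a ∷ A) B y (a≤A , sA) sB strict g≤z z≤B with a <? z
... | no a≮z rewrite colInsert-≮ {z} {a} A B a≮z =
  insertRow-colInsert-comm-≤ g z a A B y a≤A strict g≤z (≮⇒≥ a≮z)
insertRow-colInsert-comm g z (a ∷ A) [] y _ _ _ g≤z _ | yes a<z rewrite colInsert-[]-< {z} {a} A a<z =
  insertRow-colInsert-comm-<-[] g z a A y a<z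
insertRow-colInsert-comm g z (a ∷ A) (b ∷ B) y (a≤A , sA) (b≤B , sB) (a<b , strict) g≤z z≤b | yes a<z
  rewrite colInsert-∷-< {z} {a} {b} A B a<z = split< y a y<a y≮a
  where
  open ≡-Reasoning
  A₁ B₁ : List ℕ
  A₁ = proj₁ (colInsert b A B)
  B₁ = proj₂ (colInsert b A B)
  y<a : y < a → rowAfterCol g (insertRow y (a ∷ A₁)) (z ∷ B₁) ≡ colAfterRow g z (b ∷ B) (insertRow y (a ∷ A))
  y<a y<a rewrite insertRow-< A₁ y<a | insertRow-< A y<a = split< a g
    (λ a<g → begin
      rowAfterCol g (just a , y ∷ A₁) (z ∷ B₁) ≡⟨ rowAfterCol-left (y ∷ A₁) (z ∷ B₁) a<g ⟩
      (left a , y ∷ A₁ , z ∷ B₁) ≡⟨ cong (left a ,_) (sym (colInsert-∷-< {z} {y} {b} A B (<-trans y<a a<z))) ⟩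
      (left a , colInsert z (y ∷ A) (b ∷ B)) ≡⟨ sym (colAfterRow-left {g} {z} (b ∷ B) (y ∷ A) a<g) ⟩
      colAfterRow g z (b ∷ B) (just a , y ∷ A) ∎)
    (λ a≮g → begin
      rowAfterCol g (just a , y ∷ A₁) (z ∷ B₁) ≡⟨ rowAfterCol-down (y ∷ A₁) (z ∷ B₁) a≮g ⟩
      (down (proj₁ (insertRow a (z ∷ B₁))) , y ∷ A₁ , proj₂ (insertRow a (z ∷ B₁)))
        ≡⟨ cong (λ r → (down (proj₁ r) , y ∷ A₁ , proj₂ r)) (insertRow-< {a} {z} B₁ a<z) ⟩
      (down (just z) , y ∷ A₁ , a ∷ B₁) ≡⟨ cong (down (just z) ,_) (sym (colInsert-∷-< {a} {y} {b} A B y<a)) ⟩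
      (down (just z) , colInsert a (y ∷ A) (b ∷ B)) ≡⟨ sym (colAfterRow-under {g} {z} (b ∷ B) (y ∷ A) a≮g a<z) ⟩
      colAfterRow g z (b ∷ B) (just a , y ∷ A) ∎)
  -- Peel off the first column (a over z): the rest is a frame with threshold z.
  y≮a : ¬ y < a → rowAfterCol g (insertRow y (a ∷ A₁)) (z ∷ B₁) ≡ colAfterRow g z (b ∷ B) (insertRow y (a ∷ A))
  y≮a y≮a rewrite insertRow-≮ {y} {a} A₁ y≮a | insertRow-≮ {y} {a} A y≮a = begin
    rowAfterCol g (proj₁ (insertRow y A₁) , a ∷ proj₂ (insertRow y A₁)) (z ∷ B₁)
      ≡⟨ rowAfterCol-reattach g a z (insertRow y A₁) B₁ g≤z ⟩
    reattach g a z (rowAfterCol z (insertRow y A₁) B₁)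
      ≡⟨ cong (reattach g a z) (insertRow-colInsert-comm z b A B y sA sB strict z≤b b≤B) ⟩
    reattach g a z (colAfterRow z b B (insertRow y A))
      ≡⟨ sym (colAfterRow-reattach g a z b B (insertRow y A) g≤z a<z
               (λ {v} e → ≤-<-trans (≮⇒≥ y≮a) (insertRow-bump-> y A {v} (cong₂ _,_ e refl)))) ⟩
    colAfterRow g z (b ∷ B) (proj₁ (insertRow y A) , a ∷ proj₂ (insertRow y A)) ∎


-- Tableaux

row1 : Tableau → List ℕ
row1 [] = []
row1 (A ∷ _) = A

row2 : Tableau → List ℕ
row2 [] = []
row2 (_ ∷ []) = []
row2 (_ ∷ B ∷ _) = B

lowerRows : Tableau → Tableau
lowerRows [] = []
lowerRows (_ ∷ []) = []
lowerRows (_ ∷ _ ∷ Rs) = Rs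

-- The tableau with rows A, B, Rs…, omitting B when it is the empty last row.
assemble : List ℕ → List ℕ → Tableau → Tableau
assemble A [] [] = A ∷ []
assemble A (b ∷ B) Rs = A ∷ (b ∷ B) ∷ Rs
assemble A [] (R ∷ Rs) = A ∷ [] ∷ R ∷ Rs

row1-assemble : ∀ A B Rs → row1 (assemble A B Rs) ≡ A
row1-assemble A [] [] = refl
row1-assemble A (b ∷ B) Rs = refl
row1-assemble A [] (R ∷ Rs) = refl

row2-assemble : ∀ A B Rs → row2 (assemble A B Rs) ≡ B
row2-assemble A [] [] = refl
row2-assemble A (b ∷ B) Rs = refl
row2-assemble A [] (R ∷ Rs) = refl

lowerRows-assemble : ∀ A B Rs → lowerRows (assemble A B Rs) ≡ Rs
lowerRows-assemble A [] [] = refl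
lowerRows-assemble A (b ∷ B) Rs = refl
lowerRows-assemble A [] (R ∷ Rs) = refl

colInsertT : ℕ → Tableau → Tableau
colInsertT x T = assemble (proj₁ (colInsert x (row1 T) (row2 T))) (proj₂ (colInsert x (row1 T) (row2 T))) (lowerRows T)

colInsertT-assemble : ∀ x A B Rs →
  colInsertT x (assemble A B Rs) ≡ assemble (proj₁ (colInsert x A B)) (proj₂ (colInsert x A B)) Rs
colInsertT-assemble x A B Rs rewrite row1-assemble A B Rs | row2-assemble A B Rs | lowerRows-assemble A B Rs = refl

insertTᵐ : Maybe ℕ → Tableau → Tableau
insertTᵐ nothing T = T
insertTᵐ (just v) T = insertT v T

insertAll : Tableau → List ℕ → Tableau
insertAll T u = foldl (λ T x → insertT x T) T u

NonEmpty : List ℕ → Set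
NonEmpty [] = ⊥
NonEmpty (_ ∷ _) = ⊤

insertRow-nonEmpty : ∀ y A → NonEmpty (proj₂ (insertRow y A))
insertRow-nonEmpty y [] = tt
insertRow-nonEmpty y (a ∷ A) with y <? a
... | yes _ = tt
... | no _ = tt

insertT-assemble : ∀ y A B Rs →
  insertT y (assemble A B Rs) ≡
  assemble (proj₂ (insertRow y A)) (proj₂ (insertRowᵐ (proj₁ (insertRow y A)) B))
           (insertTᵐ (proj₁ (insertRowᵐ (proj₁ (insertRow y A)) B)) Rs)
insertT-assemble y A [] [] with insertRow y A
... | nothing , A' = refl
... | just v , A' = refl
insertT-assemble y A (b ∷ B) Rs with insertRow y A
... | nothing , A' = refl
... | just v , A' = row2-case (insertRow v (b ∷ B)) refl (insertRow-nonEmpty v (b ∷ B))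
  where
  row2-case : ∀ r → insertRow v (b ∷ B) ≡ r → NonEmpty (proj₂ r) →
    A' ∷ insertT v ((b ∷ B) ∷ Rs) ≡ assemble A' (proj₂ r) (insertTᵐ (proj₁ r) Rs)
  row2-case (nothing , _ ∷ _) e _ rewrite e = refl
  row2-case (just _ , _ ∷ _) e _ rewrite e = refl
insertT-assemble y A [] (R ∷ Rs) with insertRow y A
... | nothing , A' = refl
... | just v , A' = refl

RowsNonEmpty : Tableau → Set
RowsNonEmpty [] = ⊤
RowsNonEmpty (A ∷ Rs) = NonEmpty A × RowsNonEmpty Rs

RowsSorted : Tableau → Set
RowsSorted [] = ⊤
RowsSorted (A ∷ Rs) = Sorted A × RowsSorted Rs

ColumnsStrict : Tableau → Set
ColumnsStrict [] = ⊤
ColumnsStrict (A ∷ Rs) = ColStrict A (row1 Rs) × ColumnsStrict Rs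

EntriesPositive : Tableau → Set
EntriesPositive [] = ⊤
EntriesPositive (A ∷ Rs) = All (1 ≤_) A × EntriesPositive Rs

IsTableau : Tableau → Set
IsTableau T = RowsNonEmpty T × RowsSorted T × ColumnsStrict T × EntriesPositive T

isTableau-row1 : ∀ T → IsTableau T → Sorted (row1 T) × All (1 ≤_) (row1 T)
isTableau-row1 [] _ = tt , []
isTableau-row1 (A ∷ _) (_ , (sA , _) , _ , (pA , _)) = sA , pA

isTableau-row2 : ∀ T → IsTableau T → Sorted (row2 T) × ColStrict (row1 T) (row2 T)
isTableau-row2 [] _ = tt , tt
isTableau-row2 (A ∷ []) _ = tt , tt
isTableau-row2 (A ∷ B ∷ _) (_ , (_ , sB , _) , (strict , _) , _) = sB , strict

insertRow-sorted : ∀ y A → Sorted A → Sorted (proj₂ (insertRow y A))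
insertRow-sorted y [] _ = tt , tt
insertRow-sorted y (a ∷ A) (a≤A , sA) with y <? a
... | yes y<a = y≤ A a≤A , sA
  where
  y≤ : ∀ A → HeadAtLeast a A → HeadAtLeast y A
  y≤ [] _ = tt
  y≤ (b ∷ A) a≤b = ≤-trans (<⇒≤ y<a) a≤b
... | no y≮a = headAtLeast-insertRow y A a≤A (≮⇒≥ y≮a) , insertRow-sorted y A sA

insertRow-positive : ∀ y A → 1 ≤ y → All (1 ≤_) A → All (1 ≤_) (proj₂ (insertRow y A))
insertRow-positive y [] py _ = py ∷ []
insertRow-positive y (a ∷ A) py (pa ∷ pA) with y <? a
... | yes _ = py ∷ pA
... | no _ = pa ∷ insertRow-positive y A py pA

insertRow-colStrict-above : ∀ y A B → ColStrict A B → ColStrict (proj₂ (insertRow y A)) B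
insertRow-colStrict-above y A [] _ = tt
insertRow-colStrict-above y [] (b ∷ B) ()
insertRow-colStrict-above y (a ∷ A) (b ∷ B) (a<b , strict) with y <? a
... | yes y<a = <-trans y<a a<b , strict
... | no _ = a<b , insertRow-colStrict-above y A B strict

insertRow-colStrict : ∀ y A B → ColStrict A B →
  ColStrict (proj₂ (insertRow y A)) (proj₂ (insertRowᵐ (proj₁ (insertRow y A)) B))
insertRow-colStrict y [] [] _ = tt
insertRow-colStrict y [] (b ∷ B) ()
insertRow-colStrict y (a ∷ A) [] _ = bumped (insertRow y (a ∷ A)) refl
  where
  bumped : ∀ r → insertRow y (a ∷ A) ≡ r → ColStrict (proj₂ r) (proj₂ (insertRowᵐ (proj₁ r) []))
  bumped (nothing , X) e = tt
  bumped (just v , X) e with insertRow-bump-head≤ y (a ∷ A) e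
  ... | x , X' , refl , x≤y = ≤-<-trans x≤y (insertRow-bump-> y (a ∷ A) e) , tt
insertRow-colStrict y (a ∷ A) (b ∷ B) (a<b , strict) with y <? a
... | yes y<a rewrite insertRow-< {a} {b} B a<b = y<a , strict
... | no y≮a = bumped (insertRow y A) refl
  where
  bumped : ∀ r → insertRow y A ≡ r → ColStrict (a ∷ proj₂ r) (proj₂ (insertRowᵐ (proj₁ r) (b ∷ B)))
  bumped (nothing , X) e = a<b , subst (λ r → ColStrict (proj₂ r) B) e (insertRow-colStrict-above y A B strict)
  bumped (just v , X) e with v <? b
  ... | yes _ = ≤-<-trans (≮⇒≥ y≮a) (insertRow-bump-> y A e)
              , subst (λ r → ColStrict (proj₂ r) B) e (insertRow-colStrict-above y A B strict)
  ... | no _ = a<b , subst (λ r → ColStrict (proj₂ r) (proj₂ (insertRowᵐ (proj₁ r) B))) e (insertRow-colStrict y A B strict)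

row1-insertT-∷ : ∀ v A Rs → row1 (insertT v (A ∷ Rs)) ≡ proj₂ (insertRow v A)
row1-insertT-∷ v A Rs with insertRow v A
... | nothing , _ = refl
... | just _ , _ = refl

insertT-isTableau : ∀ y T → 1 ≤ y → IsTableau T → IsTableau (insertT y T)
insertT-isTableau y [] py _ = (tt , tt) , ((tt , tt) , tt) , (tt , tt) , ((py ∷ []) , tt)
insertT-isTableau y (A ∷ Rs) py ((neA , neRs) , (sA , sRs) , (strictA , strictRs) , (pA , pRs)) =
  byBump (insertRow y A) refl
  where
  byBump : ∀ r → insertRow y A ≡ r → IsTableau (insertT y (A ∷ Rs))
  byBump (nothing , A') e rewrite e =
      (subst (λ r → NonEmpty (proj₂ r)) e (insertRow-nonEmpty y A) , neRs)
    , (subst (λ r → Sorted (proj₂ r)) e (insertRow-sorted y A sA) , sRs)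
    , (subst (λ r → ColStrict (proj₂ r) (row1 Rs)) e (insertRow-colStrict-above y A (row1 Rs) strictA) , strictRs)
    , (subst (λ r → All (1 ≤_) (proj₂ r)) e (insertRow-positive y A py pA) , pRs)
  byBump (just v , A') e rewrite e
    with insertT-isTableau v Rs (≤-trans py (<⇒≤ (insertRow-bump-> y A e))) (neRs , sRs , strictRs , pRs)
  ... | (ne' , s' , strict' , p') =
      (subst (λ r → NonEmpty (proj₂ r)) e (insertRow-nonEmpty y A) , ne')
    , (subst (λ r → Sorted (proj₂ r)) e (insertRow-sorted y A sA) , s')
    , (strictTop Rs strictA , strict')
    , (subst (λ r → All (1 ≤_) (proj₂ r)) e (insertRow-positive y A py pA) , p')
    where
    strictTop : ∀ Rs → ColStrict A (row1 Rs) → ColStrict A' (row1 (insertT v Rs))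
    strictTop [] _ with insertRow-bump-head≤ y A e
    ... | x , X' , refl , x≤y = ≤-<-trans x≤y (insertRow-bump-> y A e) , tt
    strictTop (B ∷ Rs') strict rewrite row1-insertT-∷ v B Rs' =
      subst (λ r → ColStrict (proj₂ r) (proj₂ (insertRowᵐ (proj₁ r) B))) e (insertRow-colStrict y A B strict)

insertAll-isTableau : ∀ T u → IsTableau T → All (1 ≤_) u → IsTableau (insertAll T u)
insertAll-isTableau T [] isT _ = isT
insertAll-isTableau T (x ∷ u) isT (px ∷ pu) = insertAll-isTableau (insertT x T) u (insertT-isTableau x T px isT) pu

[]-isTableau : IsTableau []
[]-isTableau = tt , tt , tt , tt

P-isTableau : ∀ v → All (1 ≤_) v → IsTableau (P v)
P-isTableau v pv = insertAll-isTableau [] v []-isTableau pv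

insertT-view : ∀ y T → RowsNonEmpty T →
  insertT y T ≡ assemble (proj₂ (insertRow y (row1 T))) (proj₂ (insertRowᵐ (proj₁ (insertRow y (row1 T))) (row2 T)))
                         (insertTᵐ (proj₁ (insertRowᵐ (proj₁ (insertRow y (row1 T))) (row2 T))) (lowerRows T))
insertT-view y [] _ = refl
insertT-view y (A ∷ []) _ = insertT-assemble y A [] []
insertT-view y (A ∷ (b ∷ B) ∷ Rs) _ = insertT-assemble y A (b ∷ B) Rs
insertT-view y (A ∷ [] ∷ Rs) (_ , () , _)

row1-insertT : ∀ y T → RowsNonEmpty T → row1 (insertT y T) ≡ proj₂ (insertRow y (row1 T))
row1-insertT y T ne = trans (cong row1 (insertT-view y T ne))
  (row1-assemble (proj₂ (insertRow y (row1 T))) (proj₂ (insertRowᵐ (proj₁ (insertRow y (row1 T))) (row2 T)))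
    (insertTᵐ (proj₁ (insertRowᵐ (proj₁ (insertRow y (row1 T))) (row2 T))) (lowerRows T)))

row2-insertT : ∀ y T → RowsNonEmpty T →
  row2 (insertT y T) ≡ proj₂ (insertRowᵐ (proj₁ (insertRow y (row1 T))) (row2 T))
row2-insertT y T ne = trans (cong row2 (insertT-view y T ne))
  (row2-assemble (proj₂ (insertRow y (row1 T))) (proj₂ (insertRowᵐ (proj₁ (insertRow y (row1 T))) (row2 T)))
    (insertTᵐ (proj₁ (insertRowᵐ (proj₁ (insertRow y (row1 T))) (row2 T))) (lowerRows T)))

lowerRows-insertT : ∀ y T → RowsNonEmpty T →
  lowerRows (insertT y T) ≡ insertTᵐ (proj₁ (insertRowᵐ (proj₁ (insertRow y (row1 T))) (row2 T))) (lowerRows T)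
lowerRows-insertT y T ne = trans (cong lowerRows (insertT-view y T ne))
  (lowerRows-assemble (proj₂ (insertRow y (row1 T))) (proj₂ (insertRowᵐ (proj₁ (insertRow y (row1 T))) (row2 T)))
    (insertTᵐ (proj₁ (insertRowᵐ (proj₁ (insertRow y (row1 T))) (row2 T))) (lowerRows T)))

rowAfterCol-0 : ∀ r B →
  rowAfterCol 0 r B ≡ (down (proj₁ (insertRowᵐ (proj₁ r) B)) , proj₂ r , proj₂ (insertRowᵐ (proj₁ r) B))
rowAfterCol-0 (nothing , X) B = refl
rowAfterCol-0 (just v , X) B = rowAfterCol-down {0} X B (λ ())

colAfterRow-0 : ∀ x B r → (∀ {v} → proj₁ r ≡ just v → x ≤ v) →
  colAfterRow 0 x B r ≡ (down (proj₁ (insertRowᵐ (proj₁ r) B)) , colInsert x (proj₂ r) (proj₂ (insertRowᵐ (proj₁ r) B)))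
colAfterRow-0 x B (nothing , X) _ = refl
colAfterRow-0 x B (just v , X) x≤bump = colAfterRow-down {0} B X (λ ()) (≤⇒≯ (x≤bump refl))

down-injective : ∀ {x y} → down x ≡ down y → x ≡ y
down-injective refl = refl

row2-headAtLeast : ∀ x T → x ≤ 2 → IsTableau T → HeadAtLeast x (row2 T)
row2-headAtLeast x [] _ _ = tt
row2-headAtLeast x (A ∷ []) _ _ = tt
row2-headAtLeast x (A ∷ [] ∷ Rs) _ _ = tt
row2-headAtLeast x ([] ∷ (b ∷ B) ∷ Rs) _ (_ , _ , (() , _) , _)
row2-headAtLeast x ((a ∷ A) ∷ (b ∷ B) ∷ Rs) x≤2 (_ , _ , ((a<b , _) , _) , ((pa ∷ _) , _)) =
  ≤-trans x≤2 (≤-trans (s≤s pa) a<b)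

-- The entries of rows ≥ 3 exceed 2, so column insertion of x ≤ 2 only touches the
-- first two rows, and there it commutes with row insertion (frame threshold 0).
insertT-colInsertT-comm : ∀ x y T → x ≤ 2 → 1 ≤ y → IsTableau T →
  insertT y (colInsertT x T) ≡ colInsertT x (insertT y T)
insertT-colInsertT-comm x y T x≤2 py isT@(ne , _) = begin
    insertT y (colInsertT x T)
      ≡⟨ insertT-assemble y A B (lowerRows T) ⟩
    assemble A' B' (insertTᵐ bump₂ (lowerRows T))
      ≡⟨ cong₂ (λ r v → assemble (proj₁ r) (proj₂ r) (insertTᵐ v (lowerRows T))) (cong proj₂ rows≡)
               (down-injective (cong proj₁ rows≡)) ⟩
    assemble (proj₁ (colInsert x R1 R2)) (proj₂ (colInsert x R1 R2)) (insertTᵐ bump₂' (lowerRows T))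
      ≡⟨ sym (colInsertT-assemble x R1 R2 (insertTᵐ bump₂' (lowerRows T))) ⟩
    colInsertT x (assemble R1 R2 (insertTᵐ bump₂' (lowerRows T)))
      ≡⟨ cong (colInsertT x) (sym (insertT-view y T ne)) ⟩
    colInsertT x (insertT y T) ∎
  where
  open ≡-Reasoning
  A B A' B' R1 R2 : List ℕ
  A = proj₁ (colInsert x (row1 T) (row2 T))
  B = proj₂ (colInsert x (row1 T) (row2 T))
  A' = proj₂ (insertRow y A)
  bump₂ bump₂' : Maybe ℕ
  bump₂ = proj₁ (insertRowᵐ (proj₁ (insertRow y A)) B)
  B' = proj₂ (insertRowᵐ (proj₁ (insertRow y A)) B)
  R1 = proj₂ (insertRow y (row1 T))
  bump₂' = proj₁ (insertRowᵐ (proj₁ (insertRow y (row1 T))) (row2 T))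
  R2 = proj₂ (insertRowᵐ (proj₁ (insertRow y (row1 T))) (row2 T))
  rows≡ : (down bump₂ , A' , B') ≡ (down bump₂' , colInsert x R1 R2)
  rows≡ = begin
    (down bump₂ , A' , B') ≡⟨ sym (rowAfterCol-0 (insertRow y A) B) ⟩
    rowAfterCol 0 (insertRow y A) B
      ≡⟨ insertRow-colInsert-comm 0 x (row1 T) (row2 T) y (proj₁ (isTableau-row1 T isT)) (proj₁ (isTableau-row2 T isT))
                                  (proj₂ (isTableau-row2 T isT)) z≤n (row2-headAtLeast x T x≤2 isT) ⟩
    colAfterRow 0 x (row2 T) (insertRow y (row1 T))
      ≡⟨ colAfterRow-0 x (row2 T) (insertRow y (row1 T))
           (λ {v} e → ≤-trans x≤2 (≤-trans (s≤s py) (insertRow-bump-> y (row1 T) {v} (cong₂ _,_ e refl)))) ⟩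
    (down bump₂' , colInsert x R1 R2) ∎

insertAll-colInsertT : ∀ x T v → x ≤ 2 → IsTableau T → All (1 ≤_) v →
  insertAll (colInsertT x T) v ≡ colInsertT x (insertAll T v)
insertAll-colInsertT x T [] x≤2 isT _ = refl
insertAll-colInsertT x T (y ∷ v) x≤2 isT (py ∷ pv) rewrite insertT-colInsertT-comm x y T x≤2 py isT =
  insertAll-colInsertT x (insertT y T) v x≤2 (insertT-isTableau y T py isT) pv

P-∷ : ∀ x v → x ≤ 2 → All (1 ≤_) v → P (x ∷ v) ≡ colInsertT x (P v)
P-∷ x v x≤2 pv = insertAll-colInsertT x [] v x≤2 []-isTableau pv


-- Counting letters

weight : (ℕ → ℕ) → List ℕ → ℕ
weight f [] = 0
weight f (x ∷ A) = f x + weight f A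

weightᵐ : (ℕ → ℕ) → Maybe ℕ → ℕ
weightᵐ f nothing = 0
weightᵐ f (just v) = f v

weight-insertRow : ∀ f y A →
  weight f (proj₂ (insertRow y A)) + weightᵐ f (proj₁ (insertRow y A)) ≡ weight f A + f y
weight-insertRow f y [] = trans (+-identityʳ (f y + 0)) (+-identityʳ (f y))
weight-insertRow f y (a ∷ A) with y <? a
... | yes _ = xy∙z≈zy∙x (f y) (weight f A) (f a)
... | no _ = begin
  f a + weight f (proj₂ (insertRow y A)) + weightᵐ f (proj₁ (insertRow y A))
    ≡⟨ +-assoc (f a) _ _ ⟩
  f a + (weight f (proj₂ (insertRow y A)) + weightᵐ f (proj₁ (insertRow y A)))
    ≡⟨ cong (f a +_) (weight-insertRow f y A) ⟩
  f a + (weight f A + f y)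
    ≡⟨ +-assoc (f a) (weight f A) (f y) ⟨
  f a + weight f A + f y ∎
  where open ≡-Reasoning

weight-colInsert : ∀ f z A B →
  weight f (proj₁ (colInsert z A B)) + weight f (proj₂ (colInsert z A B)) ≡ weight f A + weight f B + f z
weight-colInsert f z [] B = trans (cong (_+ weight f B) (+-identityʳ (f z))) (+-comm (f z) (weight f B))
weight-colInsert f z (a ∷ A) [] with a <? z
... | yes _ rewrite +-identityʳ (f z) | +-identityʳ (f a + weight f A) = refl
... | no _ rewrite +-identityʳ (f z + (f a + weight f A)) | +-identityʳ (f a + weight f A) = +-comm (f z) _
weight-colInsert f z (a ∷ A) (b ∷ B) with a <? z
... | yes _ = begin
  (f a + weight f A₁) + (f z + weight f B₁) ≡⟨ shuffle (f a) (weight f A₁) (f z) (weight f B₁) ⟩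
  f a + (weight f A₁ + weight f B₁) + f z   ≡⟨ cong (λ s → f a + s + f z) (weight-colInsert f b A B) ⟩
  f a + (weight f A + weight f B + f b) + f z ≡⟨ cong (_+ f z) (unshuffle (f a) (weight f A) (weight f B) (f b)) ⟩
  (f a + weight f A) + (f b + weight f B) + f z ∎
  where
  open ≡-Reasoning
  A₁ B₁ : List ℕ
  A₁ = proj₁ (colInsert b A B)
  B₁ = proj₂ (colInsert b A B)
  shuffle : ∀ p q r s → (p + q) + (r + s) ≡ p + (q + s) + r
  shuffle = solve-∀
  unshuffle : ∀ p q r s → p + (q + r + s) ≡ (p + q) + (s + r)
  unshuffle = solve-∀
... | no _ = xy∙z≈yz∙x (f z) (f a + weight f A) (f b + weight f B)

weight-colInsert-row1-≥ : ∀ f z A B → weight f A ≤ weight f (proj₁ (colInsert z A B))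
weight-colInsert-row1-≥ f z [] B = z≤n
weight-colInsert-row1-≥ f z (a ∷ A) [] with a <? z
... | yes _ = ≤-refl
... | no _ = m≤n+m _ (f z)
weight-colInsert-row1-≥ f z (a ∷ A) (b ∷ B) with a <? z
... | yes _ = +-monoʳ-≤ (f a) (weight-colInsert-row1-≥ f b A B)
... | no _ = m≤n+m _ (f z)

indicator : ℕ → ℕ → ℕ
indicator t x with x ≟ t
... | yes _ = 1
... | no _ = 0

isLarge : ℕ → ℕ
isLarge x with 2 <? x
... | yes _ = 1
... | no _ = 0

count : ℕ → List ℕ → ℕ
count t = weight (indicator t)

countLarge : List ℕ → ℕ
countLarge = weight isLarge

indicator-self : ∀ t → indicator t t ≡ 1
indicator-self t with t ≟ t
... | yes _ = refl
... | no t≢t = ⊥-elim (t≢t refl)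

indicator-≢ : ∀ t x → x ≢ t → indicator t x ≡ 0
indicator-≢ t x x≢t with x ≟ t
... | yes x≡t = ⊥-elim (x≢t x≡t)
... | no _ = refl

isLarge->2 : ∀ x → 2 < x → isLarge x ≡ 1
isLarge->2 x 2<x with 2 <? x
... | yes _ = refl
... | no 2≮x = ⊥-elim (2≮x 2<x)

isLarge-≤2 : ∀ x → x ≤ 2 → isLarge x ≡ 0
isLarge-≤2 x x≤2 with 2 <? x
... | yes 2<x = ⊥-elim (<⇒≱ 2<x x≤2)
... | no _ = refl

indicator-partition : ∀ x → 1 ≤ x → indicator 1 x + indicator 2 x + isLarge x ≡ 1
indicator-partition (suc zero) _ = refl
indicator-partition (suc (suc zero)) _ = refl
indicator-partition (suc (suc (suc x))) _ = refl

length-count : ∀ A → All (1 ≤_) A → length A ≡ count 1 A + count 2 A + countLarge A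
length-count [] _ = refl
length-count (x ∷ A) (px ∷ pA) = begin
  suc (length A) ≡⟨ cong suc (length-count A pA) ⟩
  1 + (count 1 A + count 2 A + countLarge A)
    ≡⟨ cong (_+ (count 1 A + count 2 A + countLarge A)) (indicator-partition x px) ⟨
  (indicator 1 x + indicator 2 x + isLarge x) + (count 1 A + count 2 A + countLarge A)
    ≡⟨ interchange₃ (indicator 1 x) (indicator 2 x) (isLarge x) (count 1 A) (count 2 A) (countLarge A) ⟩
  count 1 (x ∷ A) + count 2 (x ∷ A) + countLarge (x ∷ A) ∎
  where
  open ≡-Reasoning
  interchange₃ : ∀ a b c d e f → (a + b + c) + (d + e + f) ≡ (a + d) + (b + e) + (c + f)
  interchange₃ = solve-∀


-- Profiles and letters larger than 2

Is12 : ℕ → Set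
Is12 a = a ≡ 1 ⊎ a ≡ 2

is12⇒≤2 : ∀ {a} → Is12 a → a ≤ 2
is12⇒≤2 (inj₁ refl) = s≤s z≤n
is12⇒≤2 (inj₂ refl) = ≤-refl

is12⇒positive : ∀ {a} → Is12 a → 1 ≤ a
is12⇒positive (inj₁ refl) = ≤-refl
is12⇒positive (inj₂ refl) = s≤s z≤n

all-is12⇒positive : ∀ {u} → All Is12 u → All (1 ≤_) u
all-is12⇒positive = All.map is12⇒positive

-- (number of 1s in row 1, number of 2s in row 1, number of 2s in row 2)
Profile : Set
Profile = ℕ × ℕ × ℕ

profileRows : List ℕ × List ℕ → Profile
profileRows (A , B) = count 1 A , count 2 A , count 2 B

profile : Tableau → Profile
profile T = profileRows (row1 T , row2 T)

profile-assemble : ∀ A B Rs → profile (assemble A B Rs) ≡ profileRows (A , B)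
profile-assemble A B Rs rewrite row1-assemble A B Rs | row2-assemble A B Rs = refl

-- Effect of row-inserting a letter on the profile: a 1 bumps the first 2 of row 1
-- (if any) into row 2, and a 2 only ever bumps letters larger than 2.
rowStep : ℕ → Profile → Profile
rowStep 1 (a , zero , c) = (suc a , zero , c)
rowStep 1 (a , suc b , c) = (suc a , b , suc c)
rowStep 2 (a , b , c) = (a , suc b , c)
rowStep _ s = s

-- Effect of column-inserting a letter: a 1 goes to the front of row 1; a 2 goes
-- under the first 1 that has no 2 below it, or to the front of the 2s of row 1
-- when every 1 already has one.
colStep : ℕ → Profile → Profile
colStep 1 (a , b , c) = (suc a , b , c)
colStep 2 (a , b , c) with a ≟ c
... | yes _ = (a , suc b , c)
... | no _ = (a , b , suc c)
colStep _ s = s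

sorted-head≤all : ∀ a A → Sorted (a ∷ A) → All (a ≤_) A
sorted-head≤all a [] _ = []
sorted-head≤all a (b ∷ A) (a≤b , sA) = a≤b ∷ All.map (≤-trans a≤b) (sorted-head≤all b A sA)

count-absent : ∀ t A → All (_≢ t) A → count t A ≡ 0
count-absent t [] _ = refl
count-absent t (x ∷ A) (x≢t ∷ A≢t) rewrite indicator-≢ t x x≢t = count-absent t A A≢t

count-below-head : ∀ t a A → t < a → Sorted (a ∷ A) → count t (a ∷ A) ≡ 0
count-below-head t a A t<a sA =
  count-absent t (a ∷ A) (All.map (λ a≤x → >⇒≢ (<-≤-trans t<a a≤x)) (≤-refl ∷ sorted-head≤all a A sA))

countLarge-≤2 : ∀ A → All (_≤ 2) A → countLarge A ≡ 0
countLarge-≤2 [] _ = refl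
countLarge-≤2 (x ∷ A) (x≤2 ∷ A≤2) rewrite isLarge-≤2 x x≤2 = countLarge-≤2 A A≤2

countLarge-0⇒≤2 : ∀ A → countLarge A ≡ 0 → All (_≤ 2) A
countLarge-0⇒≤2 [] _ = []
countLarge-0⇒≤2 (x ∷ A) e with 2 <? x
... | no 2≮x = ≮⇒≥ 2≮x ∷ countLarge-0⇒≤2 A e

colStrict-row2≥2 : ∀ A B → ColStrict A B → All (1 ≤_) A → All (2 ≤_) B
colStrict-row2≥2 A [] _ _ = []
colStrict-row2≥2 [] (b ∷ B) () _
colStrict-row2≥2 (a ∷ A) (b ∷ B) (a<b , strict) (pa ∷ pA) = ≤-trans (s≤s pa) a<b ∷ colStrict-row2≥2 A B strict pA

colStrict-length : ∀ A B → ColStrict A B → length B ≤ length A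
colStrict-length A [] _ = z≤n
colStrict-length [] (b ∷ B) ()
colStrict-length (a ∷ A) (b ∷ B) (_ , strict) = s≤s (colStrict-length A B strict)

count2-row2≤count1-row1 : ∀ A B → Sorted B → ColStrict A B → All (1 ≤_) A → count 2 B ≤ count 1 A
count2-row2≤count1-row1 A [] _ _ _ = z≤n
count2-row2≤count1-row1 [] (b ∷ B) _ () _
count2-row2≤count1-row1 (a ∷ A) (b ∷ B) sB (a<b , strict) (pa ∷ pA) with b ≟ 2
... | no b≢2 = ≤-trans (≤-reflexive (count-absent 2 B (All.map (λ b≤x → >⇒≢ (<-≤-trans 2<b b≤x)) (sorted-head≤all b B sB)))) z≤n
  where
  2<b : 2 < b
  2<b = ≤∧≢⇒< (≤-trans (s≤s pa) a<b) (λ 2≡b → b≢2 (sym 2≡b))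
... | yes refl with a ≟ 1
...   | yes refl = s≤s (count2-row2≤count1-row1 A B (proj₂ sB) strict pA)
...   | no a≢1 = ⊥-elim (a≢1 (≤-antisym (≤-pred a<b) pa))

weight-insertRowᵐ : ∀ f r A →
  weight f (proj₂ (insertRowᵐ r A)) + weightᵐ f (proj₁ (insertRowᵐ r A)) ≡ weight f A + weightᵐ f r
weight-insertRowᵐ f nothing A = refl
weight-insertRowᵐ f (just v) A = weight-insertRow f v A

insertRowᵐ-bump-> : ∀ r A {u v} → r ≡ just u → proj₁ (insertRowᵐ r A) ≡ just v → u < v
insertRowᵐ-bump-> (just u) A refl e = insertRow-bump-> u A (cong₂ _,_ e refl)

insertRowᵐ-bump-above : ∀ r A t → (∀ {u} → r ≡ just u → t < u) → (∀ {v} → proj₁ (insertRowᵐ r A) ≡ just v → t < v)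
insertRowᵐ-bump-above nothing A t _ ()
insertRowᵐ-bump-above (just u) A t t<r e = <-trans (t<r refl) (insertRow-bump-> u A (cong₂ _,_ e refl))

weightᵐ-indicator-absent : ∀ t r → (∀ {v} → r ≡ just v → v ≢ t) → weightᵐ (indicator t) r ≡ 0
weightᵐ-indicator-absent t nothing _ = refl
weightᵐ-indicator-absent t (just v) v≢t = indicator-≢ t v (v≢t refl)

count-insertRowᵐ : ∀ t r A → (∀ {v} → proj₁ (insertRowᵐ r A) ≡ just v → v ≢ t) →
  count t (proj₂ (insertRowᵐ r A)) ≡ count t A + weightᵐ (indicator t) r
count-insertRowᵐ t r A bump≢t = begin
  count t (proj₂ (insertRowᵐ r A))
    ≡⟨ +-identityʳ _ ⟨
  count t (proj₂ (insertRowᵐ r A)) + 0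
    ≡⟨ cong (count t (proj₂ (insertRowᵐ r A)) +_) (weightᵐ-indicator-absent t _ bump≢t) ⟨
  count t (proj₂ (insertRowᵐ r A)) + weightᵐ (indicator t) (proj₁ (insertRowᵐ r A))
    ≡⟨ weight-insertRowᵐ (indicator t) r A ⟩
  count t A + weightᵐ (indicator t) r ∎
  where open ≡-Reasoning

insertRow-1-bumps-2 : ∀ A → Sorted A → All (1 ≤_) A → 0 < count 2 A → proj₁ (insertRow 1 A) ≡ just 2
insertRow-1-bumps-2 [] _ _ ()
insertRow-1-bumps-2 (1 ∷ A) (_ , sA) (_ ∷ pA) has2 = insertRow-1-bumps-2 A sA pA has2
insertRow-1-bumps-2 (2 ∷ A) _ _ _ = refl
insertRow-1-bumps-2 (suc (suc (suc a)) ∷ A) sA _ has2 =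
  ⊥-elim (<⇒≱ has2 (≤-reflexive (count-below-head 2 (3 + a) A (s≤s (s≤s (s≤s z≤n))) sA)))

insertRow-2-bumps-large : ∀ A → 0 < countLarge A → ∃[ v ] (proj₁ (insertRow 2 A) ≡ just v × 2 < v)
insertRow-2-bumps-large (a ∷ A) hasLarge with 2 <? a
... | yes 2<a = a , refl , 2<a
... | no _ = insertRow-2-bumps-large A hasLarge

module _ (y : ℕ) (T : Tableau) where

  private
    A B A' B' : List ℕ
    A = row1 T
    B = row2 T
    bump₁ : Maybe ℕ
    bump₁ = proj₁ (insertRow y A)
    A' = proj₂ (insertRow y A)
    B' = proj₂ (insertRowᵐ bump₁ B)
    y<bump₁ : ∀ {v} → bump₁ ≡ just v → y < v
    y<bump₁ e = insertRow-bump-> y A (cong₂ _,_ e refl)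
    +1 : ∀ n → n + 1 ≡ suc n
    +1 n = +-comm n 1

  profileRows-insertRow-2 : y ≡ 2 → profileRows (A' , B') ≡ (count 1 A , suc (count 2 A) , count 2 B)
  profileRows-insertRow-2 refl = cong₂ _,_ ones₁ (cong₂ _,_ twos₁ twos₂)
    where
    ones₁ : count 1 A' ≡ count 1 A
    ones₁ = trans (count-insertRowᵐ 1 (just 2) A (λ e → >⇒≢ (<-trans (s≤s (s≤s z≤n)) (y<bump₁ e)))) (+-identityʳ _)
    twos₁ : count 2 A' ≡ suc (count 2 A)
    twos₁ = trans (count-insertRowᵐ 2 (just 2) A (λ e → >⇒≢ (y<bump₁ e))) (+1 _)
    twos₂ : count 2 B' ≡ count 2 B
    twos₂ = trans (count-insertRowᵐ 2 bump₁ B (λ e → >⇒≢ (insertRowᵐ-bump-above bump₁ B 2 y<bump₁ e)))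
                  (trans (cong (count 2 B +_) (weightᵐ-indicator-absent 2 bump₁ (λ e → >⇒≢ (y<bump₁ e)))) (+-identityʳ _))

  profileRows-insertRow-1-bumping : y ≡ 1 → IsTableau T → ∀ b → count 2 A ≡ suc b →
    profileRows (A' , B') ≡ (suc (count 1 A) , b , suc (count 2 B))
  profileRows-insertRow-1-bumping refl isT b has2 = cong₂ _,_ ones₁ (cong₂ _,_ twos₁ twos₂)
    where
    bump₁≡2 : bump₁ ≡ just 2
    bump₁≡2 = insertRow-1-bumps-2 A (proj₁ (isTableau-row1 T isT)) (proj₂ (isTableau-row1 T isT)) (subst (0 <_) (sym has2) (s≤s z≤n))
    ones₁ : count 1 A' ≡ suc (count 1 A)
    ones₁ = trans (count-insertRowᵐ 1 (just 1) A (λ e → >⇒≢ (y<bump₁ e))) (+1 _)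
    twos₁ : count 2 A' ≡ b
    twos₁ = suc-injective (begin
      suc (count 2 A')                             ≡⟨ +1 _ ⟨
      count 2 A' + 1                               ≡⟨ cong (λ r → count 2 A' + weightᵐ (indicator 2) r) bump₁≡2 ⟨
      count 2 A' + weightᵐ (indicator 2) bump₁     ≡⟨ weight-insertRow (indicator 2) 1 A ⟩
      count 2 A + 0                                ≡⟨ trans (+-identityʳ _) has2 ⟩
      suc b ∎)
      where open ≡-Reasoning
    twos₂ : count 2 B' ≡ suc (count 2 B)
    twos₂ = trans (count-insertRowᵐ 2 bump₁ B (λ e → >⇒≢ (insertRowᵐ-bump-> bump₁ B bump₁≡2 e)))
                  (trans (cong (λ r → count 2 B + weightᵐ (indicator 2) r) bump₁≡2) (+1 _))

  profileRows-insertRow-1-free : y ≡ 1 → count 2 A ≡ 0 → profileRows (A' , B') ≡ (suc (count 1 A) , 0 , count 2 B)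
  profileRows-insertRow-1-free refl no2 = cong₂ _,_ ones₁ (cong₂ _,_ twos₁ twos₂)
    where
    split0 : count 2 A' + weightᵐ (indicator 2) bump₁ ≡ 0
    split0 = trans (weight-insertRow (indicator 2) 1 A) (cong (_+ 0) no2)
    bump₁≢2 : ∀ {v} → bump₁ ≡ just v → v ≢ 2
    bump₁≢2 {v} e refl = 1≢0 (trans (sym (indicator-self 2)) (trans (cong (weightᵐ (indicator 2)) (sym e)) (m+n≡0⇒n≡0 _ split0)))
      where
      1≢0 : 1 ≢ 0
      1≢0 ()
    2<bump₁ : ∀ {v} → bump₁ ≡ just v → 2 < v
    2<bump₁ e = ≤∧≢⇒< (y<bump₁ e) (λ 2≡v → bump₁≢2 e (sym 2≡v))
    ones₁ : count 1 A' ≡ suc (count 1 A)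
    ones₁ = trans (count-insertRowᵐ 1 (just 1) A (λ e → >⇒≢ (y<bump₁ e))) (+1 _)
    twos₁ : count 2 A' ≡ 0
    twos₁ = m+n≡0⇒m≡0 _ split0
    twos₂ : count 2 B' ≡ count 2 B
    twos₂ = trans (count-insertRowᵐ 2 bump₁ B (λ e → >⇒≢ (insertRowᵐ-bump-above bump₁ B 2 2<bump₁ e)))
                  (trans (cong (count 2 B +_) (m+n≡0⇒n≡0 _ split0)) (+-identityʳ _))

  profile-insertT : Is12 y → IsTableau T → profile (insertT y T) ≡ rowStep y (profile T)
  profile-insertT y12 isT@(ne , _) =
    trans (cong profile (insertT-view y T ne)) (trans (profile-assemble A' B' _) (byLetter y12 (count 2 A) refl))
    where
    byLetter : Is12 y → ∀ b → count 2 A ≡ b → profileRows (A' , B') ≡ rowStep y (count 1 A , b , count 2 B)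
    byLetter (inj₂ refl) b refl = profileRows-insertRow-2 refl
    byLetter (inj₁ refl) (suc b) has2 = profileRows-insertRow-1-bumping refl isT b has2
    byLetter (inj₁ refl) zero no2 = profileRows-insertRow-1-free refl no2

shift : Profile → Profile
shift (a , b , c) = (suc a , b , suc c)

colStep-2-shift : ∀ a b c → colStep 2 (suc a , b , suc c) ≡ shift (colStep 2 (a , b , c))
colStep-2-shift a b c with a ≟ c | suc a ≟ suc c
... | yes _ | yes _ = refl
... | no _ | no _ = refl
... | yes a≡c | no sa≢sc = ⊥-elim (sa≢sc (cong suc a≡c))
... | no a≢c | yes sa≡sc = ⊥-elim (a≢c (suc-injective sa≡sc))

colInsert-count-absent : ∀ t z A B → indicator t z ≡ 0 → count t B ≡ 0 →
  count t (proj₁ (colInsert z A B)) ≡ count t A × count t (proj₂ (colInsert z A B)) ≡ 0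
colInsert-count-absent t z A B z≢t noB = row1≡ , row2≡
  where
  A' B' : ℕ
  A' = count t (proj₁ (colInsert z A B))
  B' = count t (proj₂ (colInsert z A B))
  total : A' + B' ≡ count t A
  total = trans (weight-colInsert (indicator t) z A B)
                (trans (cong₂ (λ p q → count t A + p + q) noB z≢t) (trans (+-identityʳ _) (+-identityʳ _)))
  row1≡ : A' ≡ count t A
  row1≡ = ≤-antisym (≤-trans (m≤m+n A' B') (≤-reflexive total)) (weight-colInsert-row1-≥ (indicator t) z A B)
  row2≡ : B' ≡ 0
  row2≡ = +-cancelˡ-≡ A' B' 0 (trans total (trans (sym row1≡) (sym (+-identityʳ A'))))

count2-under-≥2 : ∀ a A B → Sorted B → ColStrict (2 + a ∷ A) B → count 2 B ≡ 0
count2-under-≥2 a A [] _ _ = refl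
count2-under-≥2 a A (b ∷ B) sB (a<b , _) = count-below-head 2 b B (≤-trans (s≤s (s≤s (s≤s z≤n))) a<b) sB

profile-colInsert-2 : ∀ A B → Sorted A → Sorted B → ColStrict A B → All (1 ≤_) A →
  profileRows (colInsert 2 A B) ≡ colStep 2 (profileRows (A , B))
profile-colInsert-2 [] [] _ _ _ _ = refl
profile-colInsert-2 [] (b ∷ B) _ _ () _
profile-colInsert-2 (zero ∷ A) B _ _ _ (() ∷ _)
profile-colInsert-2 (1 ∷ A) [] _ _ _ _ = refl
profile-colInsert-2 (1 ∷ A) (zero ∷ B) _ _ (() , _) _
profile-colInsert-2 (1 ∷ A) (1 ∷ B) _ _ (s≤s () , _) _
profile-colInsert-2 (1 ∷ A) (2 ∷ B) (_ , sA) (_ , sB) (_ , strict) (_ ∷ pA) =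
  trans (cong shift (profile-colInsert-2 A B sA sB strict pA)) (sym (colStep-2-shift (count 1 A) (count 2 A) (count 2 B)))
profile-colInsert-2 (1 ∷ A) (suc (suc (suc b)) ∷ B) _ sB _ _
  with count-below-head 1 (3 + b) B (s≤s (s≤s z≤n)) sB | count-below-head 2 (3 + b) B (s≤s (s≤s (s≤s z≤n))) sB
... | no1 | no2 rewrite proj₁ (colInsert-count-absent 1 (3 + b) A B refl no1)
                      | proj₁ (colInsert-count-absent 2 (3 + b) A B refl no2)
                      | proj₂ (colInsert-count-absent 2 (3 + b) A B refl no2) | no2 = refl
profile-colInsert-2 (suc (suc a) ∷ A) B sA sB strict _
  with count-below-head 1 (2 + a) A (s≤s (s≤s z≤n)) sA | count2-under-≥2 a A B sB strict
... | no1 | no2 rewrite colInsert-≮ {2} {2 + a} A B (λ { (s≤s (s≤s ())) }) | no1 | no2 = refl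

profile-colInsertT : ∀ x T → Is12 x → IsTableau T → profile (colInsertT x T) ≡ colStep x (profile T)
profile-colInsertT x T x12 isT =
  trans (profile-assemble (proj₁ (colInsert x (row1 T) (row2 T))) (proj₂ (colInsert x (row1 T) (row2 T))) (lowerRows T))
        (byLetter x12)
  where
  1≤head : ∀ A → All (1 ≤_) A → HeadAtLeast 1 A
  1≤head [] _ = tt
  1≤head (a ∷ _) (pa ∷ _) = pa
  byLetter : Is12 x → profileRows (colInsert x (row1 T) (row2 T)) ≡ colStep x (profile T)
  byLetter (inj₁ refl) rewrite colInsert-headAtLeast {1} (row1 T) (row2 T) (1≤head (row1 T) (proj₂ (isTableau-row1 T isT))) = refl
  byLetter (inj₂ refl) = profile-colInsert-2 (row1 T) (row2 T) (proj₁ (isTableau-row1 T isT)) (proj₁ (isTableau-row2 T isT))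
                                             (proj₂ (isTableau-row2 T isT)) (proj₂ (isTableau-row1 T isT))

large1 : Tableau → ℕ
large1 T = countLarge (row1 T)

large2 : Tableau → ℕ
large2 T = countLarge (row2 T)

module _ (x : ℕ) (T : Tableau) where

  private
    A' B' : List ℕ
    A' = proj₁ (colInsert x (row1 T) (row2 T))
    B' = proj₂ (colInsert x (row1 T) (row2 T))

  large1-colInsertT : large1 T ≤ large1 (colInsertT x T)
  large1-colInsertT rewrite row1-assemble A' B' (lowerRows T) = weight-colInsert-row1-≥ isLarge x (row1 T) (row2 T)

  large12-colInsertT : x ≤ 2 → large1 (colInsertT x T) + large2 (colInsertT x T) ≡ large1 T + large2 T
  large12-colInsertT x≤2 rewrite row1-assemble A' B' (lowerRows T) | row2-assemble A' B' (lowerRows T) =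
    trans (weight-colInsert isLarge x (row1 T) (row2 T))
          (trans (cong (large1 T + large2 T +_) (isLarge-≤2 x x≤2)) (+-identityʳ _))

  lowerRows-colInsertT : lowerRows (colInsertT x T) ≡ lowerRows T
  lowerRows-colInsertT = lowerRows-assemble A' B' (lowerRows T)

module _ (y : ℕ) (T : Tableau) (y≤2 : y ≤ 2) (ne : RowsNonEmpty T) where

  private
    bump₁ bump₂ : Maybe ℕ
    bump₁ = proj₁ (insertRow y (row1 T))
    bump₂ = proj₁ (insertRowᵐ bump₁ (row2 T))
    T' : Tableau
    T' = insertT y T

  large1-insertT : large1 T' + weightᵐ isLarge bump₁ ≡ large1 T
  large1-insertT rewrite row1-insertT y T ne =
    trans (weight-insertRow isLarge y (row1 T)) (trans (cong (large1 T +_) (isLarge-≤2 y y≤2)) (+-identityʳ _))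

  large12-insertT : large1 T' + large2 T' + weightᵐ isLarge bump₂ ≡ large1 T + large2 T
  large12-insertT = begin
    large1 T' + large2 T' + weightᵐ isLarge bump₂   ≡⟨ +-assoc (large1 T') _ _ ⟩
    large1 T' + (large2 T' + weightᵐ isLarge bump₂) ≡⟨ cong (λ B → large1 T' + (countLarge B + weightᵐ isLarge bump₂)) (row2-insertT y T ne) ⟩
    large1 T' + (countLarge (proj₂ (insertRowᵐ bump₁ (row2 T))) + weightᵐ isLarge bump₂)
                                                    ≡⟨ cong (large1 T' +_) (weight-insertRowᵐ isLarge bump₁ (row2 T)) ⟩
    large1 T' + (large2 T + weightᵐ isLarge bump₁)  ≡⟨ x∙yz≈xz∙y (large1 T') (large2 T) _ ⟩
    large1 T' + weightᵐ isLarge bump₁ + large2 T    ≡⟨ cong (_+ large2 T) large1-insertT ⟩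
    large1 T + large2 T ∎
    where open ≡-Reasoning

  large1-insertT-≤ : large1 T' ≤ large1 T
  large1-insertT-≤ = ≤-trans (m≤m+n _ _) (≤-reflexive large1-insertT)

  large12-insertT-≤ : large1 T' + large2 T' ≤ large1 T + large2 T
  large12-insertT-≤ = ≤-trans (m≤m+n _ _) (≤-reflexive large12-insertT)

large1-insertT-2-< : ∀ T → RowsNonEmpty T → 0 < large1 T → large1 (insertT 2 T) < large1 T
large1-insertT-2-< T ne hasLarge with insertRow-2-bumps-large (row1 T) hasLarge
... | v , bump≡v , 2<v = ≤-trans (≤-reflexive (trans (+-comm 1 _) (cong (large1 (insertT 2 T) +_) bumpLarge)))
                                  (≤-reflexive (large1-insertT 2 T (s≤s (s≤s z≤n)) ne))
  where
  bumpLarge : 1 ≡ weightᵐ isLarge (proj₁ (insertRow 2 (row1 T)))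
  bumpLarge = sym (trans (cong (weightᵐ isLarge) bump≡v) (isLarge->2 v 2<v))

large12-insertT-1-< : ∀ T → IsTableau T → 0 < count 2 (row1 T) → 0 < large2 T →
  large1 (insertT 1 T) + large2 (insertT 1 T) < large1 T + large2 T
large12-insertT-1-< T isT@(ne , _) has2 hasLarge with insertRow-2-bumps-large (row2 T) hasLarge
... | v , bump≡v , 2<v = ≤-trans (≤-reflexive (trans (+-comm 1 _) (cong (large1 (insertT 1 T) + large2 (insertT 1 T) +_) bumpLarge)))
                                  (≤-reflexive (large12-insertT 1 T (s≤s z≤n) ne))
  where
  bump₁≡2 : proj₁ (insertRow 1 (row1 T)) ≡ just 2
  bump₁≡2 = insertRow-1-bumps-2 (row1 T) (proj₁ (isTableau-row1 T isT)) (proj₂ (isTableau-row1 T isT)) has2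
  bumpLarge : 1 ≡ weightᵐ isLarge (proj₁ (insertRowᵐ (proj₁ (insertRow 1 (row1 T))) (row2 T)))
  bumpLarge rewrite bump₁≡2 | bump≡v = sym (isLarge->2 v 2<v)


-- Inserting words of 1s and 2s

rowSweep : List ℕ → Profile → Profile
rowSweep u s = foldl (λ s y → rowStep y s) s u

colSweep : List ℕ → Profile → Profile
colSweep u s = foldr colStep s u

profile-insertAll : ∀ T u → IsTableau T → All Is12 u → profile (insertAll T u) ≡ rowSweep u (profile T)
profile-insertAll T [] _ _ = refl
profile-insertAll T (y ∷ u) isT (y12 ∷ u12) rewrite sym (profile-insertT y T y12 isT) =
  profile-insertAll (insertT y T) u (insertT-isTableau y T (is12⇒positive y12) isT) u12

large1-insertAll-≤ : ∀ T u → IsTableau T → All Is12 u → large1 (insertAll T u) ≤ large1 T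
large1-insertAll-≤ T [] _ _ = ≤-refl
large1-insertAll-≤ T (y ∷ u) isT@(ne , _) (y12 ∷ u12) =
  ≤-trans (large1-insertAll-≤ (insertT y T) u (insertT-isTableau y T (is12⇒positive y12) isT) u12)
          (large1-insertT-≤ y T (is12⇒≤2 y12) ne)

large12-insertAll-≤ : ∀ T u → IsTableau T → All Is12 u →
  large1 (insertAll T u) + large2 (insertAll T u) ≤ large1 T + large2 T
large12-insertAll-≤ T [] _ _ = ≤-refl
large12-insertAll-≤ T (y ∷ u) isT@(ne , _) (y12 ∷ u12) =
  ≤-trans (large12-insertAll-≤ (insertT y T) u (insertT-isTableau y T (is12⇒positive y12) isT) u12)
          (large12-insertT-≤ y T (is12⇒≤2 y12) ne)

large1-insertAll-< : ∀ T u → IsTableau T → All Is12 u → 0 < count 2 u → 0 < large1 T →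
  large1 (insertAll T u) < large1 T
large1-insertAll-< T (y ∷ u) isT@(ne , _) (inj₂ refl ∷ u12) _ hasLarge =
  ≤-<-trans (large1-insertAll-≤ (insertT 2 T) u (insertT-isTableau 2 T (s≤s z≤n) isT) u12) (large1-insertT-2-< T ne hasLarge)
large1-insertAll-< T (y ∷ u) isT@(ne , _) (inj₁ refl ∷ u12) has2 hasLarge with large1 (insertT 1 T) ≟ 0
... | yes noLarge =
  ≤-<-trans (≤-trans (large1-insertAll-≤ (insertT 1 T) u (insertT-isTableau 1 T ≤-refl isT) u12) (≤-reflexive noLarge)) hasLarge
... | no large≢0 =
  <-≤-trans (large1-insertAll-< (insertT 1 T) u (insertT-isTableau 1 T ≤-refl isT) u12 has2 (n≢0⇒n>0 large≢0))
            (large1-insertT-≤ 1 T (s≤s z≤n) ne)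

-- unblockedOnes u b: the number of 1s of u that, when u is row-inserted into a
-- tableau whose first row has b 2s and no larger letter, find no 2 to bump.
unblockedOnes : List ℕ → ℕ → ℕ
unblockedOnes [] b = 0
unblockedOnes (1 ∷ u) zero = suc (unblockedOnes u zero)
unblockedOnes (1 ∷ u) (suc b) = unblockedOnes u b
unblockedOnes (2 ∷ u) b = unblockedOnes u (suc b)
unblockedOnes (_ ∷ u) b = unblockedOnes u b

-- A blocked 1 bumps a 2 into row 2, which pushes a large letter out of row 2.
large12-insertAll-<-or-unblocked : ∀ T u → IsTableau T → All Is12 u → large1 T ≡ 0 → 0 < large2 T →
  large1 (insertAll T u) + large2 (insertAll T u) < large1 T + large2 T ⊎ unblockedOnes u (count 2 (row1 T)) ≡ count 1 u
large12-insertAll-<-or-unblocked T [] _ _ _ _ = inj₂ refl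
large12-insertAll-<-or-unblocked T (y ∷ u) isT@(ne , _) (y12 ∷ u12) noLarge₁ hasLarge₂
  with large1 (insertT y T) + large2 (insertT y T) <? large1 T + large2 T
... | yes dropped =
  inj₁ (≤-<-trans (large12-insertAll-≤ (insertT y T) u (insertT-isTableau y T (is12⇒positive y12) isT) u12) dropped)
... | no kept = byLetter y12 (count 2 (row1 T)) refl
  where
  T' : Tableau
  T' = insertT y T
  isT' : IsTableau T'
  isT' = insertT-isTableau y T (is12⇒positive y12) isT
  same : large1 T' + large2 T' ≡ large1 T + large2 T
  same = ≤-antisym (large12-insertT-≤ y T (is12⇒≤2 y12) ne) (≮⇒≥ kept)
  noLarge₁' : large1 T' ≡ 0
  noLarge₁' = n≤0⇒n≡0 (≤-trans (large1-insertT-≤ y T (is12⇒≤2 y12) ne) (≤-reflexive noLarge₁))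
  hasLarge₂' : 0 < large2 T'
  hasLarge₂' = subst (0 <_) (sym (+-cancelˡ-≡ 0 _ _ (trans (cong (_+ large2 T') (sym noLarge₁'))
                                                       (trans same (cong (_+ large2 T) noLarge₁))))) hasLarge₂
  twos' : count 2 (row1 T') ≡ proj₁ (proj₂ (rowStep y (profile T)))
  twos' = cong (λ s → proj₁ (proj₂ s)) (profile-insertT y T y12 isT)
  recurse : large1 (insertAll T' u) + large2 (insertAll T' u) < large1 T' + large2 T' ⊎ unblockedOnes u (count 2 (row1 T')) ≡ count 1 u
  recurse = large12-insertAll-<-or-unblocked T' u isT' u12 noLarge₁' hasLarge₂'
  byLetter : Is12 y → ∀ b → count 2 (row1 T) ≡ b →
    large1 (insertAll T' u) + large2 (insertAll T' u) < large1 T + large2 T ⊎ unblockedOnes (y ∷ u) b ≡ count 1 (y ∷ u)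
  byLetter (inj₂ refl) b refl = map⊎ (λ lt → <-≤-trans lt (≤-reflexive same)) (trans (cong (unblockedOnes u) (sym twos'))) recurse
  byLetter (inj₁ refl) (suc b) has2 = ⊥-elim (kept (large12-insertT-1-< T isT (subst (0 <_) (sym has2) (s≤s z≤n)) hasLarge₂))
  byLetter (inj₁ refl) zero no2 =
    map⊎ (λ lt → <-≤-trans lt (≤-reflexive same)) (λ h → cong suc (trans (cong (unblockedOnes u) (sym no2')) h)) recurse
    where
    no2' : count 2 (row1 T') ≡ 0
    no2' = trans twos' (cong (λ b → proj₁ (proj₂ (rowStep 1 (count 1 (row1 T) , b , count 2 (row2 T))))) no2)

all-positive-++ : ∀ {u w} → All Is12 u → All (1 ≤_) w → All (1 ≤_) (u ++ w)
all-positive-++ u12 pw = ++⁺ (all-is12⇒positive u12) pw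

P-++-∷ : ∀ x u w → Is12 x → All Is12 u → All (1 ≤_) w → P ((x ∷ u) ++ w) ≡ colInsertT x (P (u ++ w))
P-++-∷ x u w x12 u12 pw = P-∷ x (u ++ w) (is12⇒≤2 x12) (all-positive-++ u12 pw)

profile-P-++ : ∀ u w → All Is12 u → All (1 ≤_) w → profile (P (u ++ w)) ≡ colSweep u (profile (P w))
profile-P-++ [] w _ _ = refl
profile-P-++ (x ∷ u) w (x12 ∷ u12) pw
  rewrite P-++-∷ x u w x12 u12 pw
        | profile-colInsertT x (P (u ++ w)) x12 (P-isTableau (u ++ w) (all-positive-++ u12 pw))
        | profile-P-++ u w u12 pw = refl

large1-P-++ : ∀ u w → All Is12 u → All (1 ≤_) w → large1 (P w) ≤ large1 (P (u ++ w))
large1-P-++ [] w _ _ = ≤-refl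
large1-P-++ (x ∷ u) w (x12 ∷ u12) pw rewrite P-++-∷ x u w x12 u12 pw =
  ≤-trans (large1-P-++ u w u12 pw) (large1-colInsertT x (P (u ++ w)))

large12-P-++ : ∀ u w → All Is12 u → All (1 ≤_) w →
  large1 (P (u ++ w)) + large2 (P (u ++ w)) ≡ large1 (P w) + large2 (P w)
large12-P-++ [] w _ _ = refl
large12-P-++ (x ∷ u) w (x12 ∷ u12) pw rewrite P-++-∷ x u w x12 u12 pw =
  trans (large12-colInsertT x (P (u ++ w)) (is12⇒≤2 x12)) (large12-P-++ u w u12 pw)

lowerRows-P-++ : ∀ u w → All Is12 u → All (1 ≤_) w → lowerRows (P (u ++ w)) ≡ lowerRows (P w)
lowerRows-P-++ [] w _ _ = refl
lowerRows-P-++ (x ∷ u) w (x12 ∷ u12) pw rewrite P-++-∷ x u w x12 u12 pw =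
  trans (lowerRows-colInsertT x (P (u ++ w))) (lowerRows-P-++ u w u12 pw)

onesRow1 twosRow1 twosRow2 : Profile → ℕ
onesRow1 = proj₁
twosRow1 s = proj₁ (proj₂ s)
twosRow2 s = proj₂ (proj₂ s)

rowSweep-closedForm : ∀ u a b c → All Is12 u →
  onesRow1 (rowSweep u (a , b , c)) ≡ a + count 1 u ×
  twosRow1 (rowSweep u (a , b , c)) + count 1 u ≡ b + count 2 u + unblockedOnes u b ×
  twosRow2 (rowSweep u (a , b , c)) + unblockedOnes u b ≡ c + count 1 u
rowSweep-closedForm [] a b c _ =
  sym (+-identityʳ a) , trans (+-identityʳ b) (sym (trans (+-identityʳ _) (+-identityʳ b))) , trans (+-identityʳ c) (sym (+-identityʳ c))
rowSweep-closedForm (1 ∷ u) a zero c (_ ∷ u12) with rowSweep-closedForm u (suc a) zero c u12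
... | ones , twos , twos₂ = trans ones (sym (+-suc a (count 1 u)))
                         , trans (+-suc _ (count 1 u)) (trans (cong suc twos) (sym (+-suc _ (unblockedOnes u 0))))
                         , trans (+-suc _ (unblockedOnes u 0)) (trans (cong suc twos₂) (sym (+-suc c (count 1 u))))
rowSweep-closedForm (1 ∷ u) a (suc b) c (_ ∷ u12) with rowSweep-closedForm u (suc a) b (suc c) u12
... | ones , twos , twos₂ = trans ones (sym (+-suc a (count 1 u)))
                         , trans (+-suc _ (count 1 u)) (cong suc twos)
                         , trans twos₂ (sym (+-suc c (count 1 u)))
rowSweep-closedForm (2 ∷ u) a b c (_ ∷ u12) with rowSweep-closedForm u a (suc b) c u12
... | ones , twos , twos₂ = ones , trans twos (cong (_+ unblockedOnes u (suc b)) (sym (+-suc b (count 2 u)))) , twos₂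
rowSweep-closedForm (zero ∷ u) a b c (inj₁ () ∷ _)
rowSweep-closedForm (zero ∷ u) a b c (inj₂ () ∷ _)
rowSweep-closedForm (suc (suc (suc _)) ∷ u) a b c (inj₁ () ∷ _)
rowSweep-closedForm (suc (suc (suc _)) ∷ u) a b c (inj₂ () ∷ _)

unblockedOnes-∸ : ∀ u b → All Is12 u → unblockedOnes u b ≡ unblockedOnes u 0 ∸ b
unblockedOnes-∸ [] b _ = sym (0∸n≡0 b)
unblockedOnes-∸ (1 ∷ u) zero _ = refl
unblockedOnes-∸ (1 ∷ u) (suc b) (_ ∷ u12) = unblockedOnes-∸ u b u12
unblockedOnes-∸ (2 ∷ u) b (_ ∷ u12) =
  trans (unblockedOnes-∸ u (suc b) u12) (trans (sym (∸-+-assoc (unblockedOnes u 0) 1 b)) (cong (_∸ b) (sym (unblockedOnes-∸ u 1 u12))))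
unblockedOnes-∸ (zero ∷ u) b (inj₁ () ∷ _)
unblockedOnes-∸ (zero ∷ u) b (inj₂ () ∷ _)
unblockedOnes-∸ (suc (suc (suc _)) ∷ u) b (inj₁ () ∷ _)
unblockedOnes-∸ (suc (suc (suc _)) ∷ u) b (inj₂ () ∷ _)

rowSweep-balanced : ∀ u k d a b c → All Is12 u → count 1 u ≡ k → count 2 u ≡ k → unblockedOnes u 0 ≡ d →
  onesRow1 (rowSweep u (a , b , c)) ≡ a + k ×
  twosRow1 (rowSweep u (a , b , c)) ≡ b + (d ∸ b) ×
  twosRow2 (rowSweep u (a , b , c)) + (d ∸ b) ≡ c + k
rowSweep-balanced u k d a b c u12 refl k≡ refl with rowSweep-closedForm u a b c u12
... | ones , twos , twos₂ rewrite sym (unblockedOnes-∸ u b u12) =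
  ones , +-cancelʳ-≡ (count 1 u) _ _ (trans twos (trans (cong (λ n → b + n + unblockedOnes u b) k≡) (xy∙z≈xz∙y b _ _))) , twos₂

rowSweep-2ⁿ : ∀ n a b c → rowSweep (replicate n 2) (a , b , c) ≡ (a , n + b , c)
rowSweep-2ⁿ zero a b c = refl
rowSweep-2ⁿ (suc n) a b c = trans (rowSweep-2ⁿ n a (suc b) c) (cong (λ t → (a , t , c)) (+-suc n b))

rowSweep-1ⁿ-bumping : ∀ n a b c → rowSweep (replicate n 1) (a , n + b , c) ≡ (n + a , b , n + c)
rowSweep-1ⁿ-bumping zero a b c = refl
rowSweep-1ⁿ-bumping (suc n) a b c =
  trans (rowSweep-1ⁿ-bumping n (suc a) b (suc c)) (cong₂ (λ s t → (s , b , t)) (+-suc n a) (+-suc n c))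

rowSweep-1ⁿ : ∀ n a c → rowSweep (replicate n 1) (a , 0 , c) ≡ (n + a , 0 , c)
rowSweep-1ⁿ zero a c = refl
rowSweep-1ⁿ (suc n) a c = trans (rowSweep-1ⁿ n (suc a) c) (cong (λ s → (s , 0 , c)) (+-suc n a))

colSweep-1ⁿ : ∀ n a b c → colSweep (replicate n 1) (a , b , c) ≡ (n + a , b , c)
colSweep-1ⁿ zero a b c = refl
colSweep-1ⁿ (suc n) a b c rewrite colSweep-1ⁿ n a b c = refl

-- Here g = a ∸ c counts the 1s of row 1 with no 2 below them: the first g 2s
-- go under those, the remaining ones join row 1.
colSweep-2ⁿ : ∀ n a b c g → c + g ≡ a → colSweep (replicate n 2) (a , b , c) ≡ (a , b + (n ∸ g) , c + (g ⊓ n))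
colSweep-2ⁿ zero a b c g _ rewrite 0∸n≡0 g | ⊓-zeroʳ g | +-identityʳ b | +-identityʳ c = refl
colSweep-2ⁿ (suc n) a b c g refl rewrite colSweep-2ⁿ n (c + g) b c g refl with n <? g
... | yes n<g rewrite m≥n⇒m⊓n≡n (<⇒≤ n<g) | m≥n⇒m⊓n≡n n<g | m≤n⇒m∸n≡0 (<⇒≤ n<g) | m≤n⇒m∸n≡0 n<g
                    | +-identityʳ b with c + g ≟ c + n
...   | yes c+g≡c+n = ⊥-elim (<⇒≢ n<g (sym (+-cancelˡ-≡ c g n c+g≡c+n)))
...   | no _ = cong (λ t → (c + g , b , t)) (sym (+-suc c n))
colSweep-2ⁿ (suc n) a b c g refl | no n≮g
  rewrite m≤n⇒m⊓n≡m (≮⇒≥ n≮g) | m≤n⇒m⊓n≡m (≤-trans (≮⇒≥ n≮g) (n≤1+n n)) | +-∸-assoc 1 (≮⇒≥ n≮g) with c + g ≟ c + g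
... | yes _ = cong (λ t → (c + g , t , c + g)) (sym (+-suc b (n ∸ g)))
... | no c+g≢c+g = ⊥-elim (c+g≢c+g refl)

colSweep-2ⁿ-≤ : ∀ n a b c g → n ≤ g → c + g ≡ a → colSweep (replicate n 2) (a , b , c) ≡ (a , b , c + n)
colSweep-2ⁿ-≤ n a b c g n≤g c+g≡a
  rewrite colSweep-2ⁿ n a b c g c+g≡a | m≤n⇒m∸n≡0 n≤g | m≥n⇒m⊓n≡n n≤g | +-identityʳ b = refl

-- The row reading word of the tableau with rows 1^(j+d) 2^d and 2^j.
readingWord : ℕ → ℕ → List ℕ
readingWord j d = replicate j 2 ++ (replicate j 1 ++ (replicate d 1 ++ replicate d 2))

colSweep-readingWord : ∀ j d a b c g → c + g ≡ a →
  colSweep (readingWord j d) (a , b , c) ≡ (j + (d + a) , b + (d ∸ g) , c + (g ⊓ d) + j)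
colSweep-readingWord j d a b c g c+g≡a
  rewrite foldr-++ colStep (a , b , c) (replicate j 2) (replicate j 1 ++ (replicate d 1 ++ replicate d 2))
        | foldr-++ colStep (a , b , c) (replicate j 1) (replicate d 1 ++ replicate d 2)
        | foldr-++ colStep (a , b , c) (replicate d 1) (replicate d 2)
        | colSweep-2ⁿ d a b c g c+g≡a
        | colSweep-1ⁿ d a (b + (d ∸ g)) (c + (g ⊓ d))
        | colSweep-1ⁿ j (d + a) (b + (d ∸ g)) (c + (g ⊓ d)) =
  colSweep-2ⁿ-≤ j (j + (d + a)) (b + (d ∸ g)) (c + (g ⊓ d)) (j + ((d ∸ g) + g)) (m≤m+n j _) gap
  where
  gap : c + (g ⊓ d) + (j + ((d ∸ g) + g)) ≡ j + (d + a)
  gap = begin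
    c + (g ⊓ d) + (j + ((d ∸ g) + g)) ≡⟨ rearrange c j g (g ⊓ d) (d ∸ g) ⟩
    j + ((g ⊓ d + (d ∸ g)) + (c + g)) ≡⟨ cong₂ (λ x y → j + (x + y)) (m⊓n+n∸m≡n g d) c+g≡a ⟩
    j + (d + a) ∎
    where
    open ≡-Reasoning
    rearrange : ∀ c j g x y → c + x + (j + (y + g)) ≡ j + ((x + y) + (c + g))
    rearrange = solve-∀

-- The first and last components always agree.
colSweep-readingWord≡rowSweep⇔ : ∀ u j d a b c g → All Is12 u → count 1 u ≡ d + j → count 2 u ≡ d + j →
  unblockedOnes u 0 ≡ d → c + g ≡ a →
  colSweep (readingWord j d) (a , b , c) ≡ rowSweep u (a , b , c) ⇔ d ∸ g ≡ d ∸ b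
colSweep-readingWord≡rowSweep⇔ u j d a b c g u12 ones twos unblocked c+g≡a
  rewrite colSweep-readingWord j d a b c g c+g≡a with rowSweep-balanced u (d + j) d a b c u12 ones twos unblocked
... | ones≡ , twos≡ , twos₂≡ = mk⇔ to from
  where
  to : (j + (d + a) , b + (d ∸ g) , c + (g ⊓ d) + j) ≡ rowSweep u (a , b , c) → d ∸ g ≡ d ∸ b
  to eq = +-cancelˡ-≡ b _ _ (trans (cong twosRow1 eq) twos≡)
  from : d ∸ g ≡ d ∸ b → (j + (d + a) , b + (d ∸ g) , c + (g ⊓ d) + j) ≡ rowSweep u (a , b , c)
  from same = cong₂ _,_ (trans (reorder j d a) (sym ones≡)) (cong₂ _,_ (trans (cong (b +_) same) (sym twos≡))
    (+-cancelʳ-≡ (d ∸ b) _ _ (begin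
      c + (g ⊓ d) + j + (d ∸ b) ≡⟨ cong (c + (g ⊓ d) + j +_) same ⟨
      c + (g ⊓ d) + j + (d ∸ g) ≡⟨ regroup c (g ⊓ d) j (d ∸ g) ⟩
      c + ((g ⊓ d) + (d ∸ g) + j) ≡⟨ cong (λ x → c + (x + j)) (m⊓n+n∸m≡n g d) ⟩
      c + (d + j)               ≡⟨ twos₂≡ ⟨
      twosRow2 (rowSweep u (a , b , c)) + (d ∸ b) ∎)))
    where
    open ≡-Reasoning
    reorder : ∀ j d a → j + (d + a) ≡ a + (d + j)
    reorder = solve-∀
    regroup : ∀ c x j y → c + x + j + y ≡ c + (x + y + j)
    regroup = solve-∀


-- Tableaux whose first two rows hold only 1s and 2s

sorted-1ⁿ2ᵐ : ∀ A → Sorted A → All (1 ≤_) A → All (_≤ 2) A → A ≡ replicate (count 1 A) 1 ++ replicate (count 2 A) 2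
sorted-1ⁿ2ᵐ [] _ _ _ = refl
sorted-1ⁿ2ᵐ (zero ∷ A) _ (() ∷ _) _
sorted-1ⁿ2ᵐ (1 ∷ A) (_ , sA) (_ ∷ pA) (_ ∷ A≤2) = cong (1 ∷_) (sorted-1ⁿ2ᵐ A sA pA A≤2)
sorted-1ⁿ2ᵐ (2 ∷ A) sA@(_ , sA') (_ ∷ pA) (_ ∷ A≤2) = begin
  2 ∷ A                                                    ≡⟨ cong (2 ∷_) (sorted-1ⁿ2ᵐ A sA' pA A≤2) ⟩
  2 ∷ replicate (count 1 A) 1 ++ replicate (count 2 A) 2   ≡⟨ cong (λ n → 2 ∷ replicate n 1 ++ replicate (count 2 A) 2) no1 ⟩
  replicate (suc (count 2 A)) 2                            ≡⟨ cong (λ n → replicate n 1 ++ replicate (suc (count 2 A)) 2) no1 ⟨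
  replicate (count 1 A) 1 ++ replicate (suc (count 2 A)) 2 ∎
  where
  open ≡-Reasoning
  no1 : count 1 A ≡ 0
  no1 = count-below-head 1 2 A ≤-refl sA
sorted-1ⁿ2ᵐ (suc (suc (suc _)) ∷ A) _ _ (s≤s (s≤s ()) ∷ _)

assemble-view : ∀ T → RowsNonEmpty T → ¬ T ≡ [] → T ≡ assemble (row1 T) (row2 T) (lowerRows T)
assemble-view [] _ T≢[] = ⊥-elim (T≢[] refl)
assemble-view (A ∷ []) _ _ = refl
assemble-view (A ∷ [] ∷ Rs) (_ , () , _) _
assemble-view (A ∷ (b ∷ B) ∷ Rs) _ _ = refl

SmallTop : Tableau → Set
SmallTop T = large1 T + large2 T ≡ 0

smallTop-rows : ∀ T → IsTableau T → SmallTop T →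
  row1 T ≡ replicate (onesRow1 (profile T)) 1 ++ replicate (twosRow1 (profile T)) 2 ×
  row2 T ≡ replicate (twosRow2 (profile T)) 2
smallTop-rows T isT small = row1≡ , row2≡
  where
  sA : Sorted (row1 T) × All (1 ≤_) (row1 T)
  sA = isTableau-row1 T isT
  sB : Sorted (row2 T) × ColStrict (row1 T) (row2 T)
  sB = isTableau-row2 T isT
  row1≡ : row1 T ≡ replicate (onesRow1 (profile T)) 1 ++ replicate (twosRow1 (profile T)) 2
  row1≡ = sorted-1ⁿ2ᵐ (row1 T) (proj₁ sA) (proj₂ sA) (countLarge-0⇒≤2 (row1 T) (m+n≡0⇒m≡0 _ small))
  2≤B : All (2 ≤_) (row2 T)
  2≤B = colStrict-row2≥2 (row1 T) (row2 T) (proj₂ sB) (proj₂ sA)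
  row2≡ : row2 T ≡ replicate (twosRow2 (profile T)) 2
  row2≡ = trans (sorted-1ⁿ2ᵐ (row2 T) (proj₁ sB) (All.map (≤-trans (s≤s z≤n)) 2≤B) (countLarge-0⇒≤2 (row2 T) (m+n≡0⇒n≡0 _ small)))
                (cong (λ n → replicate n 1 ++ replicate (count 2 (row2 T)) 2) (count-absent 1 (row2 T) (All.map >⇒≢ 2≤B)))

smallTop-profile-injective : ∀ X Y → IsTableau X → IsTableau Y → ¬ X ≡ [] → ¬ Y ≡ [] → SmallTop X → SmallTop Y →
  profile X ≡ profile Y → lowerRows X ≡ lowerRows Y → X ≡ Y
smallTop-profile-injective X Y isX isY X≢[] Y≢[] smallX smallY profile≡ lower≡ = begin
  X                                              ≡⟨ assemble-view X (proj₁ isX) X≢[] ⟩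
  assemble (row1 X) (row2 X) (lowerRows X)       ≡⟨ cong₂ (λ A B → assemble A B (lowerRows X)) row1≡ row2≡ ⟩
  assemble (row1 Y) (row2 Y) (lowerRows X)       ≡⟨ cong (assemble (row1 Y) (row2 Y)) lower≡ ⟩
  assemble (row1 Y) (row2 Y) (lowerRows Y)       ≡⟨ assemble-view Y (proj₁ isY) Y≢[] ⟨
  Y ∎
  where
  open ≡-Reasoning
  row1≡ : row1 X ≡ row1 Y
  row1≡ = trans (proj₁ (smallTop-rows X isX smallX))
                (trans (cong (λ s → replicate (onesRow1 s) 1 ++ replicate (twosRow1 s) 2) profile≡)
                       (sym (proj₁ (smallTop-rows Y isY smallY))))
  row2≡ : row2 X ≡ row2 Y
  row2≡ = trans (proj₂ (smallTop-rows X isX smallX))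
                (trans (cong (λ s → replicate (twosRow2 s) 2) profile≡) (sym (proj₂ (smallTop-rows Y isY smallY))))

insertT-nonEmpty : ∀ y T → ¬ insertT y T ≡ []
insertT-nonEmpty y [] ()
insertT-nonEmpty y (A ∷ Rs) e with insertRow y A
insertT-nonEmpty y (A ∷ Rs) () | nothing , _
insertT-nonEmpty y (A ∷ Rs) () | just _ , _

insertAll-nonEmpty : ∀ T u → ¬ T ≡ [] → ¬ insertAll T u ≡ []
insertAll-nonEmpty T [] T≢[] = T≢[]
insertAll-nonEmpty T (y ∷ u) _ = insertAll-nonEmpty (insertT y T) u (insertT-nonEmpty y T)

P-nonEmpty : ∀ v → ¬ v ≡ [] → ¬ P v ≡ []
P-nonEmpty [] v≢[] = ⊥-elim (v≢[] refl)
P-nonEmpty (y ∷ v) _ = insertAll-nonEmpty (insertT y []) v (insertT-nonEmpty y [])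

insertRow-bump-∈ : ∀ {Q : ℕ → Set} y A {v} → All Q A → proj₁ (insertRow y A) ≡ just v → Q v
insertRow-bump-∈ y [] _ ()
insertRow-bump-∈ y (a ∷ A) (qa ∷ qA) e with y <? a
insertRow-bump-∈ y (a ∷ A) (qa ∷ qA) refl | yes _ = qa
... | no _ = insertRow-bump-∈ y A qA e

-- A letter that a 1 or 2 bumps out of row 1 is at least 2, so it bumps nothing
-- out of a row 2 of 2s and rows 3 onwards are untouched.
lowerRows-insertT-smallTop : ∀ y T → Is12 y → IsTableau T → SmallTop T → lowerRows (insertT y T) ≡ lowerRows T
lowerRows-insertT-smallTop y T y12 isT@(ne , _) small =
  trans (lowerRows-insertT y T ne) (cong (λ r → insertTᵐ r (lowerRows T)) (noBump₂ _ 2≤bump₁))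
  where
  B≤2 : All (_≤ 2) (row2 T)
  B≤2 = countLarge-0⇒≤2 (row2 T) (m+n≡0⇒n≡0 _ small)
  2≤bump₁ : ∀ {v} → proj₁ (insertRow y (row1 T)) ≡ just v → 2 ≤ v
  2≤bump₁ {v} e = ≤-trans (s≤s (is12⇒positive y12)) (insertRow-bump-> y (row1 T) {v} (cong₂ _,_ e refl))
  noBump₂ : ∀ r → (∀ {v} → r ≡ just v → 2 ≤ v) → proj₁ (insertRowᵐ r (row2 T)) ≡ nothing
  noBump₂ nothing _ = refl
  noBump₂ (just x) 2≤x with insertRow x (row2 T) in e
  ... | nothing , _ = refl
  ... | just v , _ = ⊥-elim (<⇒≱ (≤-<-trans (2≤x refl) (insertRow-bump-> x (row2 T) e))
                                  (insertRow-bump-∈ x (row2 T) B≤2 (cong proj₁ e)))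

lowerRows-insertAll-smallTop : ∀ T u → IsTableau T → All Is12 u → SmallTop T → lowerRows (insertAll T u) ≡ lowerRows T
lowerRows-insertAll-smallTop T [] _ _ _ = refl
lowerRows-insertAll-smallTop T (y ∷ u) isT@(ne , _) (y12 ∷ u12) small =
  trans (lowerRows-insertAll-smallTop (insertT y T) u (insertT-isTableau y T (is12⇒positive y12) isT) u12
           (n≤0⇒n≡0 (≤-trans (large12-insertT-≤ y T (is12⇒≤2 y12) ne) (≤-reflexive small))))
        (lowerRows-insertT-smallTop y T y12 isT small)


-- Singleton columns

bit : ∀ {X : Set} → Dec X → ℕ
bit (yes _) = 1
bit (no _) = 0

bit-yes : ∀ {X : Set} (x? : Dec X) → X → bit x? ≡ 1
bit-yes (yes _) _ = refl
bit-yes (no ¬x) x = ⊥-elim (¬x x)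

bit-no : ∀ {X : Set} (x? : Dec X) → ¬ X → bit x? ≡ 0
bit-no (yes x) ¬x = ⊥-elim (¬x x)
bit-no (no _) _ = refl

countUpTo : ∀ {Q : Pred ℕ _} → Decidable Q → ℕ → ℕ
countUpTo Q? zero = 0
countUpTo Q? (suc n) = countUpTo Q? n + bit (Q? n)

length-filter-∷ʳ : ∀ {Q : Pred ℕ _} (Q? : Decidable Q) xs n →
  length (filter Q? (xs ++ n ∷ [])) ≡ length (filter Q? xs) + bit (Q? n)
length-filter-∷ʳ Q? [] n with Q? n
... | yes _ = refl
... | no _ = refl
length-filter-∷ʳ Q? (x ∷ xs) n with does (Q? x)
... | true = cong suc (length-filter-∷ʳ Q? xs n)
... | false = length-filter-∷ʳ Q? xs n

length-filter-upTo : ∀ {Q : Pred ℕ _} (Q? : Decidable Q) n → length (filter Q? (upTo n)) ≡ countUpTo Q? n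
length-filter-upTo Q? zero = refl
length-filter-upTo Q? (suc n) = begin
  length (filter Q? (upTo (suc n)))          ≡⟨ cong (λ is → length (filter Q? is)) (upTo-∷ʳ n) ⟨
  length (filter Q? (upTo n ++ n ∷ []))      ≡⟨ length-filter-∷ʳ Q? (upTo n) n ⟩
  length (filter Q? (upTo n)) + bit (Q? n)   ≡⟨ cong (_+ bit (Q? n)) (length-filter-upTo Q? n) ⟩
  countUpTo Q? (suc n) ∎
  where open ≡-Reasoning

countUpTo-cong : ∀ {Q Q' : Pred ℕ _} (Q? : Decidable Q) (Q'? : Decidable Q') n →
  (∀ i → i < n → Q i → Q' i) → (∀ i → i < n → Q' i → Q i) → countUpTo Q? n ≡ countUpTo Q'? n
countUpTo-cong Q? Q'? zero _ _ = refl
countUpTo-cong Q? Q'? (suc n) to from =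
  cong₂ _+_ (countUpTo-cong Q? Q'? n (λ i i<n → to i (m<n⇒m<1+n i<n)) (λ i i<n → from i (m<n⇒m<1+n i<n)))
            (bits (Q? n) (Q'? n))
  where
  bits : ∀ q q' → bit q ≡ bit q'
  bits (yes _) (yes _) = refl
  bits (no _) (no _) = refl
  bits (yes q) (no ¬q') = ⊥-elim (¬q' (to n ≤-refl q))
  bits (no ¬q) (yes q') = ⊥-elim (¬q (from n ≤-refl q'))

Between : ℕ → ℕ → Pred ℕ _
Between lo hi i = lo ≤ i × i < hi

between? : ∀ lo hi → Decidable (Between lo hi)
between? lo hi i = (lo ≤? i) ×-dec (i <? hi)

countUpTo-between : ∀ lo hi n → countUpTo (between? lo hi) n ≡ (n ⊓ hi) ∸ lo
countUpTo-between lo hi zero = sym (0∸n≡0 lo)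
countUpTo-between lo hi (suc n) =
  trans (cong (_+ bit (between? lo hi n)) (countUpTo-between lo hi n)) (step (n <? hi) (lo ≤? n))
  where
  step : Dec (n < hi) → Dec (lo ≤ n) → (n ⊓ hi) ∸ lo + bit (between? lo hi n) ≡ (suc n ⊓ hi) ∸ lo
  step (no n≮hi) _ rewrite bit-no (between? lo hi n) (λ b → n≮hi (proj₂ b))
                         | m≥n⇒m⊓n≡n (≮⇒≥ n≮hi) | m≥n⇒m⊓n≡n (≤-trans (≮⇒≥ n≮hi) (n≤1+n n)) = +-identityʳ _
  step (yes n<hi) (yes lo≤n) rewrite m≤n⇒m⊓n≡m (<⇒≤ n<hi) | m≤n⇒m⊓n≡m n<hi | bit-yes (between? lo hi n) (lo≤n , n<hi) =
    trans (+-comm (n ∸ lo) 1) (sym (+-∸-assoc 1 lo≤n))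
  step (yes n<hi) (no lo≰n) rewrite m≤n⇒m⊓n≡m (<⇒≤ n<hi) | m≤n⇒m⊓n≡m n<hi | bit-no (between? lo hi n) (λ b → lo≰n (proj₁ b)) =
    trans (+-identityʳ _) (trans (m≤n⇒m∸n≡0 (<⇒≤ (≰⇒> lo≰n))) (sym (m≤n⇒m∸n≡0 (≰⇒> lo≰n))))

entryAt-≥length : ∀ i A → length A ≤ i → entryAt i A ≡ []
entryAt-≥length i [] _ = refl
entryAt-≥length (suc i) (x ∷ A) (s≤s |A|≤i) = entryAt-≥length i A |A|≤i

entryAt-<length : ∀ i A → i < length A → ∃[ x ] entryAt i A ≡ x ∷ []
entryAt-<length zero (x ∷ A) _ = x , refl
entryAt-<length (suc i) (x ∷ A) (s≤s i<|A|) = entryAt-<length i A i<|A|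

columnsStrict-lengths : ∀ A Rs → ColumnsStrict (A ∷ Rs) → All (λ B → length B ≤ length A) Rs
columnsStrict-lengths A [] _ = []
columnsStrict-lengths A (B ∷ Rs) (strict , stricts) =
  colStrict-length A B strict ∷ All.map (λ |C|≤|B| → ≤-trans |C|≤|B| (colStrict-length A B strict)) (columnsStrict-lengths B Rs stricts)

column-beyond : ∀ i Rs → All (λ B → length B ≤ i) Rs → concatMap (entryAt i) Rs ≡ []
column-beyond i [] _ = refl
column-beyond i (B ∷ Rs) (|B|≤i ∷ short) rewrite entryAt-≥length i B |B|≤i = column-beyond i Rs short

singletonColumns : ℕ → Tableau → ℕ
singletonColumns t T = length (filter (λ i → ≡-dec _≟_ (column i T) (t ∷ [])) (upTo (numCols T)))

SingletonTop : ℕ → Tableau → ℕ → Set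
SingletonTop t T i = length (row2 T) ≤ i × entryAt i (row1 T) ≡ t ∷ []

singletonTop? : ∀ t T → Decidable (SingletonTop t T)
singletonTop? t T i = (length (row2 T) ≤? i) ×-dec (≡-dec _≟_ (entryAt i (row1 T)) (t ∷ []))

singletonColumn⇒singletonTop : ∀ t T i → ColumnsStrict T → i < length (row1 T) → column i T ≡ t ∷ [] → SingletonTop t T i
singletonColumn⇒singletonTop t (A ∷ []) i _ _ col≡ = z≤n , trans (sym (++-identityʳ (entryAt i A))) col≡
singletonColumn⇒singletonTop t (A ∷ B ∷ Rs) i (_ , stricts) i<|A| col≡ with length B ≤? i
... | yes |B|≤i rewrite entryAt-≥length i B |B|≤i
                      | column-beyond i Rs (All.map (λ |C|≤|B| → ≤-trans |C|≤|B| |B|≤i) (columnsStrict-lengths B Rs stricts)) =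
  |B|≤i , trans (sym (++-identityʳ (entryAt i A))) col≡
... | no |B|≰i with entryAt-<length i A i<|A| | entryAt-<length i B (≰⇒> |B|≰i)
...   | x , eA | y , eB rewrite eA | eB with col≡
...     | ()

singletonTop⇒singletonColumn : ∀ t T i → ColumnsStrict T → SingletonTop t T i → column i T ≡ t ∷ []
singletonTop⇒singletonColumn t [] i _ (_ , ())
singletonTop⇒singletonColumn t (A ∷ []) i _ (_ , e) = trans (++-identityʳ (entryAt i A)) e
singletonTop⇒singletonColumn t (A ∷ B ∷ Rs) i (_ , stricts) (|B|≤i , e)
  rewrite entryAt-≥length i B |B|≤i
        | column-beyond i Rs (All.map (λ |C|≤|B| → ≤-trans |C|≤|B| |B|≤i) (columnsStrict-lengths B Rs stricts)) =
  trans (++-identityʳ (entryAt i A)) e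

singletonColumns-countUpTo : ∀ t T → ColumnsStrict T →
  singletonColumns t T ≡ countUpTo (singletonTop? t T) (length (row1 T))
singletonColumns-countUpTo t T stricts =
  trans (length-filter-upTo singleton? (numCols T))
        (trans (cong (countUpTo singleton?) (numCols≡ T))
               (countUpTo-cong singleton? (singletonTop? t T) (length (row1 T))
                  (λ i i<|A| → singletonColumn⇒singletonTop t T i stricts i<|A|)
                  (λ i _ → singletonTop⇒singletonColumn t T i stricts)))
  where
  singleton? : Decidable (λ i → column i T ≡ t ∷ [])
  singleton? = λ i → ≡-dec _≟_ (column i T) (t ∷ [])
  numCols≡ : ∀ T → numCols T ≡ length (row1 T)
  numCols≡ [] = refl
  numCols≡ (A ∷ _) = refl

entryAt-1ⁿ2ᵐ-< : ∀ p q i → i < p → entryAt i (replicate p 1 ++ replicate q 2) ≡ 1 ∷ []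
entryAt-1ⁿ2ᵐ-< (suc p) q zero _ = refl
entryAt-1ⁿ2ᵐ-< (suc p) q (suc i) (s≤s i<p) = entryAt-1ⁿ2ᵐ-< p q i i<p

entryAt-1ⁿ2ᵐ-≥ : ∀ p q i → p ≤ i → i < p + q → entryAt i (replicate p 1 ++ replicate q 2) ≡ 2 ∷ []
entryAt-1ⁿ2ᵐ-≥ zero (suc q) zero _ _ = refl
entryAt-1ⁿ2ᵐ-≥ zero (suc q) (suc i) _ (s≤s i<q) = entryAt-1ⁿ2ᵐ-≥ zero q i z≤n i<q
entryAt-1ⁿ2ᵐ-≥ (suc p) q (suc i) (s≤s p≤i) (s≤s i<p+q) = entryAt-1ⁿ2ᵐ-≥ p q i p≤i i<p+q

entryAt-1ⁿ2ᵐ-≥-≢1 : ∀ p q i → p ≤ i → entryAt i (replicate p 1 ++ replicate q 2) ≢ 1 ∷ []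
entryAt-1ⁿ2ᵐ-≥-≢1 zero (suc q) zero _ ()
entryAt-1ⁿ2ᵐ-≥-≢1 zero (suc q) (suc i) _ e = entryAt-1ⁿ2ᵐ-≥-≢1 zero q i z≤n e
entryAt-1ⁿ2ᵐ-≥-≢1 zero zero i _ ()
entryAt-1ⁿ2ᵐ-≥-≢1 (suc p) q (suc i) (s≤s p≤i) e = entryAt-1ⁿ2ᵐ-≥-≢1 p q i p≤i e

entryAt-1ⁿ2ᵐ-<-≢2 : ∀ p q i → i < p → entryAt i (replicate p 1 ++ replicate q 2) ≢ 2 ∷ []
entryAt-1ⁿ2ᵐ-<-≢2 p q i i<p e with trans (sym (entryAt-1ⁿ2ᵐ-< p q i i<p)) e
... | ()

module _ (T : Tableau) (p q : ℕ) (stricts : ColumnsStrict T) (row1≡ : row1 T ≡ replicate p 1 ++ replicate q 2) where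

  private
    |row1|≡ : length (row1 T) ≡ p + q
    |row1|≡ rewrite row1≡ = trans (length-++ (replicate p 1)) (cong₂ _+_ (length-replicate p) (length-replicate q))

  singletonColumns-1 : singletonColumns 1 T ≡ p ∸ length (row2 T)
  singletonColumns-1 = begin
    singletonColumns 1 T                              ≡⟨ singletonColumns-countUpTo 1 T stricts ⟩
    countUpTo (singletonTop? 1 T) (length (row1 T))   ≡⟨ cong (countUpTo (singletonTop? 1 T)) |row1|≡ ⟩
    countUpTo (singletonTop? 1 T) (p + q)             ≡⟨ countUpTo-cong (singletonTop? 1 T) (between? r p) (p + q) to from ⟩
    countUpTo (between? r p) (p + q)                  ≡⟨ countUpTo-between r p (p + q) ⟩
    ((p + q) ⊓ p) ∸ r                                 ≡⟨ cong (_∸ r) (m≥n⇒m⊓n≡n (m≤m+n p q)) ⟩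
    p ∸ r ∎
    where
    open ≡-Reasoning
    r : ℕ
    r = length (row2 T)
    to : ∀ i → i < p + q → SingletonTop 1 T i → Between r p i
    to i _ (r≤i , e) with i <? p
    ... | yes i<p = r≤i , i<p
    ... | no i≮p = ⊥-elim (entryAt-1ⁿ2ᵐ-≥-≢1 p q i (≮⇒≥ i≮p) (trans (cong (entryAt i) (sym row1≡)) e))
    from : ∀ i → i < p + q → Between r p i → SingletonTop 1 T i
    from i _ (r≤i , i<p) = r≤i , trans (cong (entryAt i) row1≡) (entryAt-1ⁿ2ᵐ-< p q i i<p)

  singletonColumns-2 : length (row2 T) ≤ p → singletonColumns 2 T ≡ q
  singletonColumns-2 r≤p = begin
    singletonColumns 2 T                              ≡⟨ singletonColumns-countUpTo 2 T stricts ⟩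
    countUpTo (singletonTop? 2 T) (length (row1 T))   ≡⟨ cong (countUpTo (singletonTop? 2 T)) |row1|≡ ⟩
    countUpTo (singletonTop? 2 T) (p + q)             ≡⟨ countUpTo-cong (singletonTop? 2 T) (between? p (p + q)) (p + q) to from ⟩
    countUpTo (between? p (p + q)) (p + q)            ≡⟨ countUpTo-between p (p + q) (p + q) ⟩
    ((p + q) ⊓ (p + q)) ∸ p                           ≡⟨ cong (_∸ p) (⊓-idem (p + q)) ⟩
    (p + q) ∸ p                                       ≡⟨ m+n∸m≡n p q ⟩
    q ∎
    where
    open ≡-Reasoning
    to : ∀ i → i < p + q → SingletonTop 2 T i → Between p (p + q) i
    to i i<p+q (_ , e) with i <? p
    ... | yes i<p = ⊥-elim (entryAt-1ⁿ2ᵐ-<-≢2 p q i i<p (trans (cong (entryAt i) (sym row1≡)) e))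
    ... | no i≮p = ≮⇒≥ i≮p , i<p+q
    from : ∀ i → i < p + q → Between p (p + q) i → SingletonTop 2 T i
    from i _ (p≤i , i<p+q) = ≤-trans r≤p p≤i , trans (cong (entryAt i) row1≡) (entryAt-1ⁿ2ᵐ-≥ p q i p≤i i<p+q)


-- The commutation criterion

m≡count : ∀ a u → m a u ≡ count a u
m≡count a [] = refl
m≡count a (x ∷ u) with x ≟ a
... | yes x≡a = trans (cong length (filter-accept (a ≟_) (sym x≡a))) (cong suc (m≡count a u))
... | no x≢a = trans (cong length (filter-reject (a ≟_) (λ a≡x → x≢a (sym a≡x)))) (m≡count a u)

rowT-1 : ∀ T → rowT 1 T ≡ row1 T
rowT-1 [] = refl
rowT-1 (A ∷ _) = refl

rowT-2 : ∀ T → rowT 2 T ≡ row2 T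
rowT-2 [] = refl
rowT-2 (A ∷ []) = refl
rowT-2 (A ∷ B ∷ _) = refl

P-++ : ∀ v w → P (v ++ w) ≡ insertAll (P v) w
P-++ v w = foldl-++ (λ T x → insertT x T) [] v w

∸-identity⇒0 : ∀ d g → 0 < d → d ∸ g ≡ d → g ≡ 0
∸-identity⇒0 d zero _ _ = refl
∸-identity⇒0 (suc d) (suc g) _ d∸g≡1+d = ⊥-elim (<⇒≢ (s≤s (m∸n≤m d g)) d∸g≡1+d)

∸-cancelˡ-⇔ : ∀ d g b → (d ≤ g ⊓ b ⊎ (g ≡ b × g < d)) ⇔ d ∸ g ≡ d ∸ b
∸-cancelˡ-⇔ d g b = mk⇔ from to
  where
  to : d ∸ g ≡ d ∸ b → d ≤ g ⊓ b ⊎ (g ≡ b × g < d)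
  to e with d ≤? g | d ≤? b
  ... | yes d≤g | yes d≤b = inj₁ (⊓-glb d≤g d≤b)
  ... | yes d≤g | no d≰b = ⊥-elim (<-irrefl (trans (sym (m≤n⇒m∸n≡0 d≤g)) e) (m<n⇒0<n∸m (≰⇒> d≰b)))
  ... | no d≰g | yes d≤b = ⊥-elim (<-irrefl (trans (sym (m≤n⇒m∸n≡0 d≤b)) (sym e)) (m<n⇒0<n∸m (≰⇒> d≰g)))
  ... | no d≰g | no d≰b = inj₂ (∸-cancelˡ-≡ (<⇒≤ (≰⇒> d≰g)) (<⇒≤ (≰⇒> d≰b)) e , ≰⇒> d≰g)
  from : d ≤ g ⊓ b ⊎ (g ≡ b × g < d) → d ∸ g ≡ d ∸ b
  from (inj₁ d≤g⊓b) = trans (m≤n⇒m∸n≡0 (≤-trans d≤g⊓b (m⊓n≤m g b))) (sym (m≤n⇒m∸n≡0 (≤-trans d≤g⊓b (m⊓n≤n g b))))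
  from (inj₂ (refl , _)) = refl

smallTop-singletonColumns : ∀ T → IsTableau T → SmallTop T →
  singletonColumns 1 T ≡ onesRow1 (profile T) ∸ twosRow2 (profile T) × singletonColumns 2 T ≡ twosRow1 (profile T)
smallTop-singletonColumns T isT@(_ , _ , stricts , _) small =
  trans (singletonColumns-1 T p q stricts row1≡) (cong (p ∸_) |row2|≡) ,
  singletonColumns-2 T p q stricts row1≡ (≤-trans (≤-reflexive |row2|≡)
    (count2-row2≤count1-row1 (row1 T) (row2 T) (proj₁ (isTableau-row2 T isT)) (proj₂ (isTableau-row2 T isT)) (proj₂ (isTableau-row1 T isT))))
  where
  p q : ℕ
  p = onesRow1 (profile T)
  q = twosRow1 (profile T)
  row1≡ : row1 T ≡ replicate p 1 ++ replicate q 2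
  row1≡ = proj₁ (smallTop-rows T isT small)
  |row2|≡ : length (row2 T) ≡ twosRow2 (profile T)
  |row2|≡ = trans (cong length (proj₂ (smallTop-rows T isT small))) (length-replicate _)

module _ {v : List ℕ} (v12 : All Is12 v) where

  P-small-smallTop : SmallTop (P v)
  P-small-smallTop = n≤0⇒n≡0 (large12-insertAll-≤ [] v []-isTableau v12)

  lowerRows-P-small : lowerRows (P v) ≡ []
  lowerRows-P-small = lowerRows-insertAll-smallTop [] v []-isTableau v12 refl

  profile-P-small : profile (P v) ≡ rowSweep v (0 , 0 , 0)
  profile-P-small = profile-insertAll [] v []-isTableau v12

P-small-injective : ∀ v v' → All Is12 v → All Is12 v' → ¬ v ≡ [] → ¬ v' ≡ [] →
  rowSweep v (0 , 0 , 0) ≡ rowSweep v' (0 , 0 , 0) → P v ≡ P v'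
P-small-injective v v' v12 v'12 v≢[] v'≢[] sweep≡ =
  smallTop-profile-injective (P v) (P v') (P-isTableau v (all-is12⇒positive v12)) (P-isTableau v' (all-is12⇒positive v'12))
    (P-nonEmpty v v≢[]) (P-nonEmpty v' v'≢[]) (P-small-smallTop v12) (P-small-smallTop v'12)
    (trans (profile-P-small v12) (trans sweep≡ (sym (profile-P-small v'12))))
    (trans (lowerRows-P-small v12) (sym (lowerRows-P-small v'12)))

readingWord-is12 : ∀ j d → All Is12 (readingWord j d)
readingWord-is12 j d =
  ++⁺ (replicate⁺ j (inj₂ refl)) (++⁺ (replicate⁺ j (inj₁ refl)) (++⁺ (replicate⁺ d (inj₁ refl)) (replicate⁺ d (inj₂ refl))))

readingWord-nonEmpty : ∀ j d → 1 ≤ d + j → ¬ readingWord j d ≡ []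
readingWord-nonEmpty (suc j) d _ ()
readingWord-nonEmpty zero (suc d) _ ()

rowSweep-readingWord : ∀ j d → rowSweep (readingWord j d) (0 , 0 , 0) ≡ (d + j , d , j)
rowSweep-readingWord j d = begin
  rowSweep (replicate j 2 ++ (1ʲ ++ (1ᵈ ++ 2ᵈ))) (0 , 0 , 0)
    ≡⟨ foldl-++ step (0 , 0 , 0) (replicate j 2) _ ⟩
  rowSweep (1ʲ ++ (1ᵈ ++ 2ᵈ)) (rowSweep (replicate j 2) (0 , 0 , 0))
    ≡⟨ cong (rowSweep (1ʲ ++ (1ᵈ ++ 2ᵈ))) (rowSweep-2ⁿ j 0 0 0) ⟩
  rowSweep (1ʲ ++ (1ᵈ ++ 2ᵈ)) (0 , j + 0 , 0)
    ≡⟨ foldl-++ step (0 , j + 0 , 0) 1ʲ _ ⟩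
  rowSweep (1ᵈ ++ 2ᵈ) (rowSweep 1ʲ (0 , j + 0 , 0))
    ≡⟨ cong (rowSweep (1ᵈ ++ 2ᵈ)) (rowSweep-1ⁿ-bumping j 0 0 0) ⟩
  rowSweep (1ᵈ ++ 2ᵈ) (j + 0 , 0 , j + 0)
    ≡⟨ foldl-++ step (j + 0 , 0 , j + 0) 1ᵈ _ ⟩
  rowSweep 2ᵈ (rowSweep 1ᵈ (j + 0 , 0 , j + 0))
    ≡⟨ cong (rowSweep 2ᵈ) (rowSweep-1ⁿ d (j + 0) (j + 0)) ⟩
  rowSweep 2ᵈ (d + (j + 0) , 0 , j + 0)
    ≡⟨ rowSweep-2ⁿ d (d + (j + 0)) 0 (j + 0) ⟩
  (d + (j + 0) , d + 0 , j + 0)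
    ≡⟨ cong₂ (λ x y → (d + x , y , x)) (+-identityʳ j) (+-identityʳ d) ⟩
  (d + j , d , j) ∎
  where
  open ≡-Reasoning
  step : Profile → ℕ → Profile
  step = λ s y → rowStep y s
  1ʲ 1ᵈ 2ᵈ : List ℕ
  1ʲ = replicate j 1
  1ᵈ = replicate d 1
  2ᵈ = replicate d 2

-- A word u with k 1s and k 2s has the same insertion tableau as the reading word
-- of the tableau with rows 1^k 2^d and 2^j, where d counts its unblocked 1s.
module Balanced (u : List ℕ) (u12 : All Is12 u) (twos≡ones : count 2 u ≡ count 1 u) (1≤k : 1 ≤ count 1 u) where

  k d j : ℕ
  k = count 1 u
  d = unblockedOnes u 0
  j = twosRow2 (rowSweep u (0 , 0 , 0))

  private
    sweep : onesRow1 (rowSweep u (0 , 0 , 0)) ≡ k × twosRow1 (rowSweep u (0 , 0 , 0)) ≡ d × j + d ≡ k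
    sweep = rowSweep-balanced u k d 0 0 0 u12 refl twos≡ones refl

  d+j≡k : d + j ≡ k
  d+j≡k = trans (+-comm d j) (proj₂ (proj₂ sweep))

  rowSweep-u : rowSweep u (0 , 0 , 0) ≡ (d + j , d , j)
  rowSweep-u = cong₂ _,_ (trans (proj₁ sweep) (sym d+j≡k)) (cong₂ _,_ (proj₁ (proj₂ sweep)) refl)

  u≢[] : ¬ u ≡ []
  u≢[] refl = <-irrefl refl 1≤k

  readingWord≢[] : ¬ readingWord j d ≡ []
  readingWord≢[] = readingWord-nonEmpty j d (subst (1 ≤_) (sym d+j≡k) 1≤k)

  P-u≡P-readingWord : P u ≡ P (readingWord j d)
  P-u≡P-readingWord = P-small-injective u (readingWord j d) u12 (readingWord-is12 j d) u≢[] readingWord≢[]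
                                        (trans rowSweep-u (sym (rowSweep-readingWord j d)))

  c1-u : c 1 u ≡ d
  c1-u = begin
    c 1 u                                                    ≡⟨ proj₁ (smallTop-singletonColumns (P u) isPu (P-small-smallTop u12)) ⟩
    onesRow1 (profile (P u)) ∸ twosRow2 (profile (P u))      ≡⟨ cong (λ s → onesRow1 s ∸ twosRow2 s) (trans (profile-P-small u12) rowSweep-u) ⟩
    (d + j) ∸ j                                              ≡⟨ m+n∸n≡m d j ⟩
    d ∎
    where
    open ≡-Reasoning
    isPu : IsTableau (P u)
    isPu = P-isTableau u (all-is12⇒positive u12)

module Commuting (u : List ℕ) (u12 : All Is12 u) (twos≡ones : count 2 u ≡ count 1 u) (1≤k : 1 ≤ count 1 u)
                 (w : List ℕ) (pw : All (1 ≤_) w) where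

  open Balanced u u12 twos≡ones 1≤k public

  T : Tableau
  T = P w
  isT = P-isTableau w pw
  -- g is the number of 1s in row 1 of T with no 2 below them.
  a b c₂ g : ℕ
  a = onesRow1 (profile T)
  b = twosRow1 (profile T)
  c₂ = twosRow2 (profile T)
  g = a ∸ c₂

  c₂+g≡a : c₂ + g ≡ a
  c₂+g≡a = m+[n∸m]≡n (count2-row2≤count1-row1 (row1 T) (row2 T) (proj₁ (isTableau-row2 T isT)) (proj₂ (isTableau-row2 T isT))
                                                (proj₂ (isTableau-row1 T isT)))

  private
    rw : List ℕ
    rw = readingWord j d
    rw12 : All Is12 rw
    rw12 = readingWord-is12 j d
    u++w≡ : P (u ++ w) ≡ P (rw ++ w)
    u++w≡ = trans (P-++ u w) (trans (cong (λ S → insertAll S w) P-u≡P-readingWord) (sym (P-++ rw w)))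

  -- The two tableaux are P(u w), built by column insertions of the reading word
  -- into T, and P(w u), built by row insertions of u into T.
  profiles⇔ : colSweep rw (profile T) ≡ rowSweep u (profile T) ⇔ d ∸ g ≡ d ∸ b
  profiles⇔ = colSweep-readingWord≡rowSweep⇔ u j d a b c₂ g u12 (sym d+j≡k) (trans twos≡ones (sym d+j≡k)) refl c₂+g≡a

  commute⇒profiles : w ∈C u → d ∸ g ≡ d ∸ b
  commute⇒profiles comm = Equivalence.to profiles⇔ (begin
    colSweep rw (profile T)    ≡⟨ profile-P-++ rw w rw12 pw ⟨
    profile (P (rw ++ w))      ≡⟨ cong profile (trans (sym u++w≡) (trans comm (P-++ w u))) ⟩
    profile (insertAll T u)    ≡⟨ profile-insertAll T u isT u12 ⟩
    rowSweep u (profile T) ∎)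
    where open ≡-Reasoning

  profiles⇒commute : SmallTop T → d ∸ g ≡ d ∸ b → w ∈C u
  profiles⇒commute small same = trans u++w≡ (trans X≡Y (sym (P-++ w u)))
    where
    pu : All (1 ≤_) u
    pu = all-is12⇒positive u12
    X≡Y : P (rw ++ w) ≡ insertAll T u
    X≡Y = smallTop-profile-injective (P (rw ++ w)) (insertAll T u)
      (P-isTableau (rw ++ w) (all-positive-++ rw12 pw)) (insertAll-isTableau T u isT pu)
      (P-nonEmpty (rw ++ w) (λ rw++w≡[] → readingWord≢[] (++-conicalˡ rw w rw++w≡[])))
      (λ Y≡[] → P-nonEmpty (w ++ u) (λ w++u≡[] → u≢[] (++-conicalʳ w u w++u≡[])) (trans (P-++ w u) Y≡[]))
      (trans (large12-P-++ rw w rw12 pw) small)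
      (n≤0⇒n≡0 (≤-trans (large12-insertAll-≤ T u isT u12) (≤-reflexive small)))
      (trans (profile-P-++ rw w rw12 pw) (trans (Equivalence.from profiles⇔ same) (sym (profile-insertAll T u isT u12))))
      (trans (lowerRows-P-++ rw w rw12 pw) (sym (lowerRows-insertAll-smallTop T u isT u12 small)))

  -- If every 1 of u is unblocked, row 1 of T has no 2, and equal profiles force
  -- each of its 1s to have a 2 below it; row 2, which also holds a large letter,
  -- is then too long.
  allUnblocked⇒⊥ : w ∈C u → large1 T ≡ 0 → 0 < large2 T → unblockedOnes u b ≡ k → ⊥
  allUnblocked⇒⊥ comm noLarge₁ hasLarge₂ allUnblocked =
    <-irrefl refl (<-≤-trans c₂<|row2| (≤-trans |row2|≤|row1| (≤-reflexive |row1|≡c₂)))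
    where
      d∸b≡k : d ∸ b ≡ k
      d∸b≡k = trans (sym (unblockedOnes-∸ u b u12)) allUnblocked
      d≡k : d ≡ k
      d≡k = ≤-antisym (≤-trans (m≤m+n d j) (≤-reflexive d+j≡k)) (≤-trans (≤-reflexive (sym d∸b≡k)) (m∸n≤m d b))
      0<d : 0 < d
      0<d = subst (1 ≤_) (sym d≡k) 1≤k
      b≡0 : b ≡ 0
      b≡0 = ∸-identity⇒0 d b 0<d (trans d∸b≡k (sym d≡k))
      g≡0 : g ≡ 0
      g≡0 = ∸-identity⇒0 d g 0<d (trans (commute⇒profiles comm) (trans d∸b≡k (sym d≡k)))
      a≡c₂ : a ≡ c₂
      a≡c₂ = ≤-antisym (m∸n≡0⇒m≤n g≡0) (m+n≤o⇒m≤o c₂ (≤-reflexive c₂+g≡a))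
      |row1|≡c₂ : length (row1 T) ≡ c₂
      |row1|≡c₂ = begin
        length (row1 T)       ≡⟨ length-count (row1 T) (proj₂ (isTableau-row1 T isT)) ⟩
        a + b + large1 T      ≡⟨ cong₂ (λ x y → x + y + large1 T) a≡c₂ b≡0 ⟩
        c₂ + 0 + large1 T     ≡⟨ cong (c₂ + 0 +_) noLarge₁ ⟩
        c₂ + 0 + 0            ≡⟨ trans (+-identityʳ _) (+-identityʳ c₂) ⟩
        c₂ ∎
        where open ≡-Reasoning
      c₂<|row2| : c₂ < length (row2 T)
      c₂<|row2| = begin-strict
        c₂                                     <⟨ m<m+n c₂ hasLarge₂ ⟩
        c₂ + large2 T                          ≤⟨ m≤n+m _ (count 1 (row2 T)) ⟩
        count 1 (row2 T) + (c₂ + large2 T)     ≡⟨ +-assoc (count 1 (row2 T)) c₂ (large2 T) ⟨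
        count 1 (row2 T) + c₂ + large2 T       ≡⟨ length-count (row2 T) 1≤row2 ⟨
        length (row2 T) ∎
        where
        open ≤-Reasoning
        1≤row2 : All (1 ≤_) (row2 T)
        1≤row2 = All.map (≤-trans (s≤s z≤n))
                   (colStrict-row2≥2 (row1 T) (row2 T) (proj₂ (isTableau-row2 T isT)) (proj₂ (isTableau-row1 T isT)))
      |row2|≤|row1| : length (row2 T) ≤ length (row1 T)
      |row2|≤|row1| = colStrict-length (row1 T) (row2 T) (proj₂ (isTableau-row2 T isT))

  commute⇒smallTop : w ∈C u → SmallTop T
  commute⇒smallTop comm = cong₂ _+_ noLarge₁ noLarge₂
    where
    ≡insertAll : P (u ++ w) ≡ insertAll T u
    ≡insertAll = trans comm (P-++ w u)
    -- u contains a 2, and row-inserting a 2 bumps a large letter out of row 1, while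
    -- column insertion never removes one.
    noLarge₁ : large1 T ≡ 0
    noLarge₁ with large1 T ≟ 0
    ... | yes none = none
    ... | no some = ⊥-elim (<-irrefl refl (≤-<-trans (≤-trans (large1-P-++ u w u12 pw) (≤-reflexive (cong large1 ≡insertAll)))
                             (large1-insertAll-< T u isT u12 (subst (1 ≤_) (sym twos≡ones) 1≤k) (n≢0⇒n>0 some))))
    noLarge₂ : large2 T ≡ 0
    noLarge₂ with large2 T ≟ 0
    ... | yes none = none
    ... | no some with large12-insertAll-<-or-unblocked T u isT u12 noLarge₁ (n≢0⇒n>0 some)
    ...   | inj₁ dropped = ⊥-elim (<-irrefl (trans (sym (cong (λ X → large1 X + large2 X) ≡insertAll)) (large12-P-++ u w u12 pw)) dropped)
    ...   | inj₂ allUnblocked = ⊥-elim (allUnblocked⇒⊥ comm noLarge₁ (n≢0⇒n>0 some) allUnblocked)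

  rows⇔smallTop : (All (_≤ 2) (R 1 w) × All (_≤ 2) (R 2 w)) ⇔ SmallTop T
  rows⇔smallTop = mk⇔
    (λ (row1≤2 , row2≤2) → cong₂ _+_ (countLarge-≤2 (row1 T) (subst (All (_≤ 2)) (rowT-1 T) row1≤2))
                                       (countLarge-≤2 (row2 T) (subst (All (_≤ 2)) (rowT-2 T) row2≤2)))
    (λ small → subst (All (_≤ 2)) (sym (rowT-1 T)) (countLarge-0⇒≤2 (row1 T) (m+n≡0⇒m≡0 _ small))
             , subst (All (_≤ 2)) (sym (rowT-2 T)) (countLarge-0⇒≤2 (row2 T) (m+n≡0⇒n≡0 _ small)))

  conditionA⇔ : SmallTop T → (c 1 u ≤ c 1 w ⊓ c 2 w ⊎ (c 1 w ≡ c 2 w × c 1 w < c 1 u)) ⇔ d ∸ g ≡ d ∸ b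
  conditionA⇔ small =
    subst (λ e → (e ≤ c 1 w ⊓ c 2 w ⊎ (c 1 w ≡ c 2 w × c 1 w < e)) ⇔ d ∸ g ≡ d ∸ b) (sym c1-u)
      (subst₂ (λ x y → (d ≤ x ⊓ y ⊎ (x ≡ y × x < d)) ⇔ d ∸ g ≡ d ∸ b) (sym c1-w) (sym c2-w) (∸-cancelˡ-⇔ d g b))
    where
    c1-w : c 1 w ≡ g
    c1-w = proj₁ (smallTop-singletonColumns T isT small)
    c2-w : c 2 w ≡ b
    c2-w = proj₂ (smallTop-singletonColumns T isT small)

theorem2p9 : (n : ℕ) (u : List ℕ) → length u ≡ n →
    All (λ a → a ≡ 1 ⊎ a ≡ 2) u →
    m 1 u ≡ m 2 u → 1 ≤ m 1 u →
    (w : List ℕ) → All (λ a → 1 ≤ a) w →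
    (w ∈C u) ⇔
      ((c 1 u ≤ c 1 w ⊓ c 2 w ⊎ (c 1 w ≡ c 2 w × c 1 w < c 1 u))
       × (All (λ a → a ≤ 2) (R 1 w) × All (λ a → a ≤ 2) (R 2 w)))
theorem2p9 _ u _ u12 m₁≡m₂ 1≤m₁ w pw = mk⇔
  (λ comm → let small = commute⇒smallTop comm in
    Equivalence.from (conditionA⇔ small) (commute⇒profiles comm) , Equivalence.from rows⇔smallTop small)
  (λ (conditionA , rows) → let small = Equivalence.to rows⇔smallTop rows in
    profiles⇒commute small (Equivalence.to (conditionA⇔ small) conditionA))
  where
  open Commuting u u12 (trans (sym (m≡count 2 u)) (trans (sym m₁≡m₂) (m≡count 1 u))) (subst (1 ≤_) (m≡count 1 u) 1≤m₁) w pw
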